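{- A matroid $M$ is $M(\mathcal{W}_2)$-connected if and only if $M$ is connected and non-uniform.
   Context: A matroid $M$ with $|E(M)| \geq 2$ is $N$-connected if for every pair of distinct elements $e,f \in E(M)$ there is a minor of $M$ isomorphic to $N$ whose ground set contains $\{e,f\}$. $M(\mathcal{W}_2)$ is the cycle matroid of the rank-2 wheel, i.e. the rank-2 matroid on four elements $\{a,b,c,d\}$ whose circuits are $\{a,b\}$, $\{a,c,d\}$, $\{b,c,d\}$. -}

module Defs where

open import Data.Nat using (ℕ; _≤_; _<_)
import Data.Nat as ℕ
open import Data.Bool using (Bool; true; false; _∧_; _∨_; not)
open import Data.Fin using (Fin; zero; suc)
open import Data.Fin.Subset using (Subset; _∈_; _∉_; _⊆_; _∪_; _∩_; _-_; ⁅_⁆; ⊥; ∣_∣; Empty)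
open import Data.Vec using (Vec; _∷_; []; lookup)
open import Data.Product using (Σ; ∃; ∃-syntax; _×_; _,_)
open import Relation.Binary.PropositionalEquality using (_≡_; _≢_; refl)
open import Relation.Nullary using (¬_)
open import Function.Bundles using (_⇔_)
open import Function.Definitions using (Injective)
open import Data.Bool.Properties using () renaming (_≟_ to _≟ᵇ_)
open import Data.Nat.Properties using (_≤?_; _<?_)
open import Data.Fin.Subset.Properties using (_∈?_; _⊆?_)
open import Data.Fin.Properties using (any?)
open import Data.Product.Properties using ()
open import Relation.Nullary using (Dec; yes; no)
open import Relation.Nullary.Decidable using (from-yes; _×-dec_; _→-dec_; ¬?)
open import Relation.Unary using (Pred; Decidable)
open import Level using (Level)

record Matroid (n : ℕ) : Set where
  field
    indep       : Subset n → Bool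
    indep-empty : indep ⊥ ≡ true
    indep-down  : ∀ X Y → X ⊆ Y → indep Y ≡ true → indep X ≡ true
    indep-aug   : ∀ X Y → indep X ≡ true → indep Y ≡ true → ∣ X ∣ < ∣ Y ∣ →
                  ∃[ e ] (e ∈ Y × e ∉ X × indep (⁅ e ⁆ ∪ X) ≡ true)

open Matroid public

IsCircuit : ∀ {n} → Matroid n → Subset n → Set
IsCircuit M C = indep M C ≡ false × (∀ e → e ∈ C → indep M (C - e) ≡ true)

Connected : ∀ {n} → Matroid n → Set
Connected {n} M = ∀ (e f : Fin n) → e ≢ f → ∃[ C ] (IsCircuit M C × e ∈ C × f ∈ C)

Uniform : ∀ {n} → Matroid n → Set
Uniform {n} M = ∃[ r ] (∀ (X : Subset n) → (indep M X ≡ true ⇔ ∣ X ∣ ≤ r))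

IsBasisOf : ∀ {n} → Matroid n → Subset n → Subset n → Set
IsBasisOf M J C = J ⊆ C × indep M J ≡ true × (∀ e → e ∈ C → e ∉ J → indep M (⁅ e ⁆ ∪ J) ≡ false)

-- Y (disjoint from C) is independent in the contraction M / C:
-- Y ∪ B is independent in M for a basis B of M|C.
IndepContract : ∀ {n} → Matroid n → Subset n → Subset n → Set
IndepContract M C Y = ∃[ J ] (IsBasisOf M J C × indep M (Y ∪ J) ≡ true)

-- M has a minor M / C \ D (with D the complement of C ∪ S) on ground set S that is
-- isomorphic (via a bijection φ : Fin k → S) to the matroid on Fin k with
-- independence predicate indN, and whose ground set S contains e and f.
HasMinorUsing : ∀ {n k} → Matroid n → (Subset k → Bool) → Fin n → Fin n → Set
HasMinorUsing {n} {k} M indN e f =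
  ∃[ C ] ∃[ S ] (Empty (C ∩ S) × e ∈ S × f ∈ S ×
    Σ (Fin k → Fin n) λ φ →
      Injective _≡_ _≡_ φ × (∀ x → φ x ∈ S) × (∀ y → y ∈ S → ∃[ x ] φ x ≡ y) ×
      (∀ (X : Subset k) (Y : Subset n) → Y ⊆ S → (∀ x → (x ∈ X ⇔ φ x ∈ Y)) →
         (indN X ≡ true ⇔ IndepContract M C Y)))

NConnected : ∀ {n k} → Matroid n → Matroid k → Set
NConnected {n} M N = (2 ≤ n) × (∀ (e f : Fin n) → e ≢ f → HasMinorUsing M (indep N) e f)

indepW₂ : Subset 4 → Bool
indepW₂ (a ∷ b ∷ c ∷ d ∷ []) = not (a ∧ b) ∧ not (a ∧ c ∧ d) ∧ not (b ∧ c ∧ d)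

allSubset? : ∀ {ℓ : Level} {n} {P : Subset n → Set ℓ} → (∀ X → Dec (P X)) → Dec (∀ X → P X)
allSubset? {n = ℕ.zero} P? with P? []
... | yes p = yes λ { [] → p }
... | no ¬p = no λ h → ¬p (h [])
allSubset? {n = ℕ.suc n} {P = P} P? with allSubset? (λ X → P? (true ∷ X)) | allSubset? (λ X → P? (false ∷ X))
... | yes p | yes q = yes λ { (true ∷ X) → p X ; (false ∷ X) → q X }
... | no ¬p | _ = no λ h → ¬p (λ X → h (true ∷ X))
... | yes _ | no ¬q = no λ h → ¬q (λ X → h (false ∷ X))

W₂ : Matroid 4
W₂ = record
  { indep = indepW₂
  ; indep-empty = refl
  ; indep-down = from-yes (allSubset? λ X → allSubset? λ Y →
      (X ⊆? Y) →-dec ((indepW₂ Y ≟ᵇ true) →-dec (indepW₂ X ≟ᵇ true)))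
  ; indep-aug = from-yes (allSubset? λ X → allSubset? λ Y →
      (indepW₂ X ≟ᵇ true) →-dec ((indepW₂ Y ≟ᵇ true) →-dec ((∣ X ∣ <? ∣ Y ∣) →-dec
        any? λ e → (e ∈? Y) ×-dec (¬? (e ∈? X) ×-dec (indepW₂ (⁅ e ⁆ ∪ X) ≟ᵇ true)))))
  }

-- If M has an M(W₂)-minor through every pair e, f, then a circuit of M(W₂) through their
-- preimages lifts to a circuit of M through e and f, so M is connected; and since M(W₂) has a
-- dependent and an independent pair, so does a contraction of M, which rules out uniformity.
--
-- Conversely, let M be connected and non-uniform, e ≠ f, and D a circuit through both. Call a
-- circuit an ear of D if it meets D and has a point outside cl(D). If D has an ear, an ear with
-- fewest points outside D can be chosen to avoid e, and it forms a theta with D; contracting all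
-- but four suitably placed points of the theta (one on each of two paths, two on the third)
-- leaves M(W₂) on a set containing e and f. If no circuit through e and f has an ear,
-- connectivity puts every point in their closure, so all of them span M and have size r(M) + 1.
-- Non-uniformity then yields a circuit Q of size at most r(M); a circuit D through e and f
-- sharing the most points with Q is joined to a circuit of ⁅ x ⁆ ∪ D with x ∈ Q ∖ D, again
-- forming a theta with the required four points.

module Submission where

open import Defs
open import Data.Nat using (ℕ; zero; suc; _+_; _≤_; _<_; z≤n; s≤s; s≤s⁻¹)
open import Data.Nat.Properties using (module ≤-Reasoning; n<1+n; suc-injective; ≤-refl; ≤-trans; ≤-<-trans; ≤⇒≯; ≤-reflexive; +-suc; +-monoʳ-≤; ≮⇒≥; ≰⇒>; _≤?_; _<?_)
open import Data.Bool using (Bool; true; false)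
open import Data.Bool.Properties using (¬-not; not-¬) renaming (_≟_ to _≟ᵇ_)
open import Data.Fin using (Fin; zero; suc; #_)
open import Data.Fin.Properties using (any?; all?) renaming (_≟_ to _≟ᶠ_)
open import Data.Fin.Subset using (Subset; _∈_; _∉_; _⊆_; _∪_; _∩_; _-_; _─_; ⁅_⁆; ⊥; ∁; ∣_∣; Empty; Nonempty)
open import Data.Fin.Subset.Properties using (_∈?_; _⊆?_; x∈⁅x⁆; x∈⁅y⁆⇒x≡y; x∉⁅y⁆⇒x≢y; x∈p∪q⁻; x∈p∩q⁺; x∈p∩q⁻; p⊆p∪q; q⊆p∪q; ∪-comm; ⊆-antisym; ⊆-refl; p⊆q⇒∣p∣≤∣q∣; p⊂q⇒∣p∣<∣q∣; x∈p∧x∉q⇒x∈p─q; x∈p∧x≢y⇒x∈p-y; x∈p⇒∣p-x∣<∣p∣; p─q⊆p; p─⊥≡p; ⊥⊆; drop-∷-Empty; ∣⁅x⁆∣≡1; x∈∁p⇒x∉p; x∉p⇒x∈∁p; anySubset?; nonempty?)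
open import Data.Vec using (_∷_; []; tabulate)
open import Data.Vec.Base using (here; there)
open import Data.Vec.Properties using (lookup∘tabulate; lookup⇒[]=; []=⇒lookup)
open import Data.Product using (∃; ∃-syntax; _×_; _,_; proj₁; proj₂)
open import Data.Sum using (_⊎_; inj₁; inj₂; [_,_]′)
open import Data.Empty using (⊥-elim)
open import Relation.Binary.PropositionalEquality using (_≡_; _≢_; refl; sym; trans; cong; subst; module ≡-Reasoning)
open import Relation.Nullary using (¬_; Dec; yes; no; does)
open import Relation.Nullary.Decidable using (_×-dec_; ¬?; _→-dec_; decidable-stable; dec-true; from-yes)
open import Function.Base using (_∘_)
open import Function.Bundles using (_⇔_; mk⇔; Equivalence)
open import Function.Definitions using (Injective)

private variable
  n k : ℕ

x∈p─q⁻ : ∀ {x : Fin n} (p q : Subset n) → x ∈ p ─ q → x ∈ p × x ∉ q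
x∈p─q⁻ (s ∷ p) (true ∷ q) (there x∈) = let x∈p , x∉q = x∈p─q⁻ p q x∈ in there x∈p , λ { (there x∈q) → x∉q x∈q }
x∈p─q⁻ (true ∷ p) (false ∷ q) here = here , λ ()
x∈p─q⁻ (s ∷ p) (false ∷ q) (there x∈) = let x∈p , x∉q = x∈p─q⁻ p q x∈ in there x∈p , λ { (there x∈q) → x∉q x∈q }

x∈p-y⁻ : ∀ {x y : Fin n} (p : Subset n) → x ∈ p - y → x ∈ p × x ≢ y
x∈p-y⁻ p x∈ = let x∈p , x∉y = x∈p─q⁻ p _ x∈ in x∈p , x∉⁅y⁆⇒x≢y x∉y

x∉p-x : ∀ (p : Subset n) (x : Fin n) → x ∉ p - x
x∉p-x p x x∈ = proj₂ (x∈p-y⁻ p x∈) refl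

x∈⁅y⁆∪⁅z⁆⁻ : ∀ {x y z : Fin n} → x ∈ ⁅ y ⁆ ∪ ⁅ z ⁆ → x ≡ y ⊎ x ≡ z
x∈⁅y⁆∪⁅z⁆⁻ {y = y} {z} x∈ with x∈p∪q⁻ ⁅ y ⁆ ⁅ z ⁆ x∈
... | inj₁ x∈y = inj₁ (x∈⁅y⁆⇒x≡y y x∈y)
... | inj₂ x∈z = inj₂ (x∈⁅y⁆⇒x≡y z x∈z)

x∈p∪q∧x∉q⇒x∈p : ∀ {x : Fin n} {p q : Subset n} → x ∈ p ∪ q → x ∉ q → x ∈ p
x∈p∪q∧x∉q⇒x∈p {p = p} {q} x∈ x∉q = [ (λ x∈p → x∈p) , (λ x∈q → ⊥-elim (x∉q x∈q)) ]′ (x∈p∪q⁻ p q x∈)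

x∈p∪q∧x∉p⇒x∈q : ∀ {x : Fin n} {p q : Subset n} → x ∈ p ∪ q → x ∉ p → x ∈ q
x∈p∪q∧x∉p⇒x∈q {p = p} {q} x∈ x∉p = [ (λ x∈p → ⊥-elim (x∉p x∈p)) , (λ x∈q → x∈q) ]′ (x∈p∪q⁻ p q x∈)

x∉⁅y⁆∪p-x : ∀ {x y : Fin n} {p : Subset n} → x ≢ y → x ∉ ⁅ y ⁆ ∪ (p - x)
x∉⁅y⁆∪p-x {x = x} {y} {p} x≢y x∈ = [ x≢y ∘ x∈⁅y⁆⇒x≡y y , x∉p-x p x ]′ (x∈p∪q⁻ ⁅ y ⁆ (p - x) x∈)

⊈⇒∃∈∖ : ∀ {p q : Subset n} → ¬ p ⊆ q → ∃[ x ] (x ∈ p × x ∉ q)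
⊈⇒∃∈∖ {p = p} {q = q} p⊈q with any? (λ x → x ∈? p ×-dec ¬? (x ∈? q))
... | yes w = w
... | no ¬w = ⊥-elim (p⊈q λ {x} x∈p → decidable-stable (x ∈? q) λ x∉q → ¬w (x , x∈p , x∉q))

⊆∧∈∖⇒∣p∣<∣q∣ : ∀ {p q : Subset n} {x} → p ⊆ q → x ∈ q → x ∉ p → ∣ p ∣ < ∣ q ∣
⊆∧∈∖⇒∣p∣<∣q∣ p⊆q x∈q x∉p = p⊂q⇒∣p∣<∣q∣ (p⊆q , _ , x∈q , x∉p)

p─r⊆q─r : ∀ {p q r : Subset n} → (∀ {x} → x ∈ p → x ∉ r → x ∈ q) → p ─ r ⊆ q ─ r
p─r⊆q─r {p = p} {r = r} h x∈ = let x∈p , x∉r = x∈p─q⁻ p r x∈ in x∈p∧x∉q⇒x∈p─q (h x∈p x∉r) x∉r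

∣p∪q∣≡∣p∣+∣q∣ : ∀ (p q : Subset n) → Empty (p ∩ q) → ∣ p ∪ q ∣ ≡ ∣ p ∣ + ∣ q ∣
∣p∪q∣≡∣p∣+∣q∣ [] [] _ = refl
∣p∪q∣≡∣p∣+∣q∣ (true ∷ p) (true ∷ q) p∩q≡∅ = ⊥-elim (p∩q≡∅ (zero , here))
∣p∪q∣≡∣p∣+∣q∣ (true ∷ p) (false ∷ q) p∩q≡∅ = cong suc (∣p∪q∣≡∣p∣+∣q∣ p q (drop-∷-Empty p∩q≡∅))
∣p∪q∣≡∣p∣+∣q∣ (false ∷ p) (true ∷ q) p∩q≡∅ =
  trans (cong suc (∣p∪q∣≡∣p∣+∣q∣ p q (drop-∷-Empty p∩q≡∅))) (sym (+-suc ∣ p ∣ ∣ q ∣))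
∣p∪q∣≡∣p∣+∣q∣ (false ∷ p) (false ∷ q) p∩q≡∅ = ∣p∪q∣≡∣p∣+∣q∣ p q (drop-∷-Empty p∩q≡∅)

∣⁅x⁆∪p∣≡1+∣p∣ : ∀ {x : Fin n} (p : Subset n) → x ∉ p → ∣ ⁅ x ⁆ ∪ p ∣ ≡ suc ∣ p ∣
∣⁅x⁆∪p∣≡1+∣p∣ {x = x} p x∉p = trans (∣p∪q∣≡∣p∣+∣q∣ ⁅ x ⁆ p disjoint) (cong (_+ ∣ p ∣) (∣⁅x⁆∣≡1 x))
  where
  disjoint : Empty (⁅ x ⁆ ∩ p)
  disjoint (y , y∈) = let y∈x , y∈p = x∈p∩q⁻ ⁅ x ⁆ p y∈ in x∉p (subst (_∈ p) (x∈⁅y⁆⇒x≡y x y∈x) y∈p)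

1+∣p-x∣≡∣p∣ : ∀ {x : Fin n} (p : Subset n) → x ∈ p → suc ∣ p - x ∣ ≡ ∣ p ∣
1+∣p-x∣≡∣p∣ (true ∷ p) here = cong (suc ∘ ∣_∣) (p─⊥≡p p)
1+∣p-x∣≡∣p∣ (true ∷ p) (there x∈p) = cong suc (1+∣p-x∣≡∣p∣ p x∈p)
1+∣p-x∣≡∣p∣ (false ∷ p) (there x∈p) = 1+∣p-x∣≡∣p∣ p x∈p

∣p-x∣≡∣p-y∣ : ∀ {x y : Fin n} (p : Subset n) → x ∈ p → y ∈ p → ∣ p - x ∣ ≡ ∣ p - y ∣
∣p-x∣≡∣p-y∣ p x∈p y∈p = suc-injective (trans (1+∣p-x∣≡∣p∣ p x∈p) (sym (1+∣p-x∣≡∣p∣ p y∈p)))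

∣⁅x⁆∪p-y∣≡1+∣p-z∣ : ∀ {x y z : Fin n} (p : Subset n) → x ∉ p → y ∈ p → z ∈ p →
                    ∣ ⁅ x ⁆ ∪ (p - y) ∣ ≡ suc ∣ p - z ∣
∣⁅x⁆∪p-y∣≡1+∣p-z∣ p x∉p y∈p z∈p =
  trans (∣⁅x⁆∪p∣≡1+∣p∣ (p - _) (x∉p ∘ proj₁ ∘ x∈p-y⁻ p)) (cong suc (∣p-x∣≡∣p-y∣ p y∈p z∈p))

p⊆q∧∣q∣≤∣p∣⇒q⊆p : ∀ {p q : Subset n} → p ⊆ q → ∣ q ∣ ≤ ∣ p ∣ → q ⊆ p
p⊆q∧∣q∣≤∣p∣⇒q⊆p {p = p} p⊆q ∣q∣≤∣p∣ {x} x∈q with x ∈? p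
... | yes x∈p = x∈p
... | no x∉p = ⊥-elim (≤⇒≯ ∣q∣≤∣p∣ (⊆∧∈∖⇒∣p∣<∣q∣ p⊆q x∈q x∉p))

Minimum : (Subset n → Set) → (Subset n → ℕ) → Subset n → Set
Minimum P μ X = P X × ∀ Y → P Y → μ X ≤ μ Y

module _ {P : Subset n → Set} (P? : ∀ X → Dec (P X)) (μ : Subset n → ℕ) where

  minimum-below : ∀ k X → μ X < k → P X → ∃ (Minimum P μ)
  minimum-below (suc k) X μX≤k pX with anySubset? (λ Y → P? Y ×-dec (μ Y <? μ X))
  ... | yes (Y , pY , μY<μX) = minimum-below k Y (≤-trans μY<μX (s≤s⁻¹ μX≤k)) pY
  ... | no ∄smaller = X , pX , λ Y pY → ≮⇒≥ λ μY<μX → ∄smaller (Y , pY , μY<μX)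

  minimum : ∀ X → P X → ∃ (Minimum P μ)
  minimum X = minimum-below (suc (μ X)) X ≤-refl

module MatroidProperties {n : ℕ} (M : Matroid n) where

  Indep Dep : Subset n → Set
  Indep X = indep M X ≡ true
  Dep X = indep M X ≡ false

  Circuit : Subset n → Set
  Circuit = IsCircuit M

  indep⊎dep : ∀ X → Indep X ⊎ Dep X
  indep⊎dep X with indep M X
  ... | true = inj₁ refl
  ... | false = inj₂ refl

  indep⇒¬dep : ∀ {X} → Indep X → ¬ Dep X
  indep⇒¬dep = not-¬

  indep-⊆ : ∀ {X Y} → X ⊆ Y → Indep Y → Indep X
  indep-⊆ {X} {Y} = indep-down M X Y

  dep-⊇ : ∀ {X Y} → X ⊆ Y → Dep X → Dep Y
  dep-⊇ {Y = Y} X⊆Y dX with indep⊎dep Y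
  ... | inj₁ iY = ⊥-elim (indep⇒¬dep (indep-⊆ X⊆Y iY) dX)
  ... | inj₂ dY = dY

  circuit? : ∀ C → Dec (Circuit C)
  circuit? C = (indep M C ≟ᵇ false) ×-dec all? (λ e → (e ∈? C) →-dec (indep M (C - e) ≟ᵇ true))

  dep⇒circuit⊆ : ∀ X → Dep X → ∃[ C ] (Circuit C × C ⊆ X)
  dep⇒circuit⊆ X dX with minimum (λ C → (C ⊆? X) ×-dec (indep M C ≟ᵇ false)) ∣_∣ X (⊆-refl , dX)
  ... | C , (C⊆X , dC) , minimal = C , (dC , C-e-indep) , C⊆X
    where
    C-e-indep : ∀ e → e ∈ C → Indep (C - e)
    C-e-indep e e∈C = ¬-not λ dC-e →
      ≤⇒≯ (minimal (C - e) ((λ x∈ → C⊆X (proj₁ (x∈p-y⁻ C x∈))) , dC-e)) (x∈p⇒∣p-x∣<∣p∣ e∈C)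

  circuit⊆circuit⇒≡ : ∀ {C D} → Circuit C → Circuit D → C ⊆ D → C ≡ D
  circuit⊆circuit⇒≡ {C} {D} cC cD C⊆D = ⊆-antisym C⊆D D⊆C
    where
    D⊆C : D ⊆ C
    D⊆C {d} d∈D with d ∈? C
    ... | yes d∈C = d∈C
    ... | no d∉C = ⊥-elim (indep⇒¬dep (indep-⊆ C⊆D-d (proj₂ cD d d∈D)) (proj₁ cC))
      where
      C⊆D-d : C ⊆ D - d
      C⊆D-d {c} c∈C = x∈p∧x≢y⇒x∈p-y (C⊆D c∈C) λ { refl → d∉C c∈C }

  circuit≢⇒∃∈∖ : ∀ {C D} → Circuit C → Circuit D → C ≢ D → ∃[ x ] (x ∈ C × x ∉ D)
  circuit≢⇒∃∈∖ {C} {D} cC cD C≢D with C ⊆? D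
  ... | yes C⊆D = ⊥-elim (C≢D (circuit⊆circuit⇒≡ cC cD C⊆D))
  ... | no C⊈D = ⊈⇒∃∈∖ C⊈D

  MaximalIn : Subset n → Subset n → Set
  MaximalIn U K = ∀ h → h ∈ U → h ∉ K → Dep (⁅ h ⁆ ∪ K)

  extend-to-maximal : ∀ U J → J ⊆ U → Indep J → ∃[ K ] (J ⊆ K × K ⊆ U × Indep K × MaximalIn U K)
  extend-to-maximal U J J⊆U iJ
    with minimum (λ K → (J ⊆? K) ×-dec ((K ⊆? U) ×-dec (indep M K ≟ᵇ true))) (∣_∣ ∘ ∁) J (⊆-refl , J⊆U , iJ)
  ... | K , (J⊆K , K⊆U , iK) , minimal = K , J⊆K , K⊆U , iK , maximal
    where
    -- minimising the complement maximises K
    maximal : MaximalIn U K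
    maximal h h∈U h∉K = ¬-not λ ihK → ≤⇒≯
      (minimal (⁅ h ⁆ ∪ K) ((λ x∈J → q⊆p∪q ⁅ h ⁆ K (J⊆K x∈J)) , hK⊆U , ihK))
      (⊆∧∈∖⇒∣p∣<∣q∣ ∁hK⊆∁K (x∉p⇒x∈∁p h∉K) (λ h∈∁ → x∈∁p⇒x∉p h∈∁ (p⊆p∪q K (x∈⁅x⁆ h))))
      where
      hK⊆U : ⁅ h ⁆ ∪ K ⊆ U
      hK⊆U x∈ with x∈p∪q⁻ ⁅ h ⁆ K x∈
      ... | inj₁ x∈h = subst (_∈ U) (sym (x∈⁅y⁆⇒x≡y h x∈h)) h∈U
      ... | inj₂ x∈K = K⊆U x∈K
      ∁hK⊆∁K : ∁ (⁅ h ⁆ ∪ K) ⊆ ∁ K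
      ∁hK⊆∁K x∈ = x∉p⇒x∈∁p λ x∈K → x∈∁p⇒x∉p x∈ (q⊆p∪q ⁅ h ⁆ K x∈K)

  -- Extend C₁ - f (f ∈ C₁ ∖ C₂) to a maximal independent K inside C₁ ∪ C₂; K misses f and some
  -- g ∈ C₂, so it is smaller than (C₁ ∪ C₂) - e and could be augmented from it if that were independent.
  circuit-elimination : ∀ {C₁ C₂ e} → Circuit C₁ → Circuit C₂ → C₁ ≢ C₂ → e ∈ C₁ → e ∈ C₂ →
                        ∃[ C ] (Circuit C × C ⊆ (C₁ ∪ C₂) - e)
  circuit-elimination {C₁} {C₂} {e} cC₁ cC₂ C₁≢C₂ e∈C₁ e∈C₂ with indep⊎dep ((C₁ ∪ C₂) - e)
  ... | inj₂ dU-e = dep⇒circuit⊆ _ dU-e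
  ... | inj₁ iU-e with circuit≢⇒∃∈∖ cC₁ cC₂ C₁≢C₂
  ... | f , f∈C₁ , f∉C₂
    with extend-to-maximal (C₁ ∪ C₂) (C₁ - f) (λ x∈ → p⊆p∪q C₂ (proj₁ (x∈p-y⁻ C₁ x∈))) (proj₂ cC₁ f f∈C₁)
  ... | K , C₁-f⊆K , K⊆U , iK , maximal =
    let g , g∈C₂ , g∉K = C₂⊈K
        h , h∈U-e , h∉K , ihK = indep-aug M K (U - e) iK iU-e (∣K∣<∣U-e∣ g∈C₂ g∉K)
    in ⊥-elim (indep⇒¬dep ihK (maximal h (proj₁ (x∈p-y⁻ U h∈U-e)) h∉K))
    where
    U = C₁ ∪ C₂
    f∉K : f ∉ K
    f∉K f∈K = indep⇒¬dep (indep-⊆ C₁⊆K iK) (proj₁ cC₁)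
      where
      C₁⊆K : C₁ ⊆ K
      C₁⊆K {c} c∈C₁ with c ≟ᶠ f
      ... | yes refl = f∈K
      ... | no c≢f = C₁-f⊆K (x∈p∧x≢y⇒x∈p-y c∈C₁ c≢f)
    C₂⊈K : ∃[ g ] (g ∈ C₂ × g ∉ K)
    C₂⊈K with C₂ ⊆? K
    ... | yes C₂⊆K = ⊥-elim (indep⇒¬dep (indep-⊆ C₂⊆K iK) (proj₁ cC₂))
    ... | no C₂⊈K = ⊈⇒∃∈∖ C₂⊈K
    ∣K∣<∣U-e∣ : ∀ {g} → g ∈ C₂ → g ∉ K → ∣ K ∣ < ∣ U - e ∣
    ∣K∣<∣U-e∣ {g} g∈C₂ g∉K = begin-strict
      ∣ K ∣             ≤⟨ p⊆q⇒∣p∣≤∣q∣ K⊆U-f-g ⟩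
      ∣ (U - f) - g ∣   <⟨ n<1+n _ ⟩
      suc ∣ (U - f) - g ∣ ≡⟨ 1+∣p-x∣≡∣p∣ (U - f) g∈U-f ⟩
      ∣ U - f ∣         ≡⟨ ∣p-x∣≡∣p-y∣ U (p⊆p∪q C₂ f∈C₁) (p⊆p∪q C₂ e∈C₁) ⟩
      ∣ U - e ∣         ∎
      where
      open ≤-Reasoning
      K⊆U-f-g : K ⊆ (U - f) - g
      K⊆U-f-g k∈K = x∈p∧x≢y⇒x∈p-y (x∈p∧x≢y⇒x∈p-y (K⊆U k∈K) λ { refl → f∉K k∈K }) λ { refl → g∉K k∈K }
      g∈U-f : g ∈ U - f
      g∈U-f = x∈p∧x≢y⇒x∈p-y (q⊆p∪q C₁ C₂ g∈C₂) λ { refl → f∉C₂ g∈C₂ }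

  -- If the circuit C₃ from weak elimination misses f, take g ∈ C₃ ∖ C₁ ⊆ C₂; eliminating g from
  -- C₂, C₃ keeping e, and then e from C₁ and the result keeping f, only uses unions that omit
  -- a point of C₁ ∪ C₂, so induction on ∣ C₁ ∪ C₂ ∣ applies.
  strong-circuit-elimination-below :
    ∀ k {C₁ C₂ e f} → ∣ C₁ ∪ C₂ ∣ < k → Circuit C₁ → Circuit C₂ → e ∈ C₁ → e ∈ C₂ → f ∈ C₁ → f ∉ C₂ →
    ∃[ C ] (Circuit C × f ∈ C × C ⊆ (C₁ ∪ C₂) - e)
  strong-circuit-elimination-below (suc k) {C₁} {C₂} {e} {f} ∣U∣≤k cC₁ cC₂ e∈C₁ e∈C₂ f∈C₁ f∉C₂
    with circuit-elimination cC₁ cC₂ (λ C₁≡C₂ → f∉C₂ (subst (f ∈_) C₁≡C₂ f∈C₁)) e∈C₁ e∈C₂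
  ... | C₃ , cC₃ , C₃⊆U-e with f ∈? C₃
  ... | yes f∈C₃ = C₃ , cC₃ , f∈C₃ , C₃⊆U-e
  ... | no f∉C₃ with circuit≢⇒∃∈∖ cC₃ cC₁ C₃≢C₁
    where
    C₃≢C₁ : C₃ ≢ C₁
    C₃≢C₁ C₃≡C₁ = x∉p-x (C₁ ∪ C₂) e (C₃⊆U-e (subst (e ∈_) (sym C₃≡C₁) e∈C₁))
  ... | g , g∈C₃ , g∉C₁ =
    eliminate-e (strong-circuit-elimination-below k ∣C₂∪C₃∣≤k cC₂ cC₃ g∈C₂ g∈C₃ e∈C₂ e∉C₃)
    where
    U = C₁ ∪ C₂
    e∉C₃ : e ∉ C₃
    e∉C₃ e∈C₃ = x∉p-x U e (C₃⊆U-e e∈C₃)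
    g∈C₂ : g ∈ C₂
    g∈C₂ with x∈p∪q⁻ C₁ C₂ (proj₁ (x∈p-y⁻ U (C₃⊆U-e g∈C₃)))
    ... | inj₁ g∈C₁ = ⊥-elim (g∉C₁ g∈C₁)
    ... | inj₂ g∈C₂ = g∈C₂
    C₂∪C₃⊆U-f : C₂ ∪ C₃ ⊆ U - f
    C₂∪C₃⊆U-f {x} x∈ with x∈p∪q⁻ C₂ C₃ x∈
    ... | inj₁ x∈C₂ = x∈p∧x≢y⇒x∈p-y (q⊆p∪q C₁ C₂ x∈C₂) λ { refl → f∉C₂ x∈C₂ }
    ... | inj₂ x∈C₃ = x∈p∧x≢y⇒x∈p-y (proj₁ (x∈p-y⁻ U (C₃⊆U-e x∈C₃))) λ { refl → f∉C₃ x∈C₃ }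
    ∣U-x∣<k : ∀ {x} → x ∈ U → ∣ U - x ∣ < k
    ∣U-x∣<k x∈U = subst (_≤ k) (sym (1+∣p-x∣≡∣p∣ U x∈U)) (s≤s⁻¹ ∣U∣≤k)
    ∣C₂∪C₃∣≤k = ≤-<-trans (p⊆q⇒∣p∣≤∣q∣ C₂∪C₃⊆U-f) (∣U-x∣<k (p⊆p∪q C₂ f∈C₁))
    eliminate-e : ∃[ C₄ ] (Circuit C₄ × e ∈ C₄ × C₄ ⊆ (C₂ ∪ C₃) - g) → ∃[ C ] (Circuit C × f ∈ C × C ⊆ U - e)
    eliminate-e (C₄ , cC₄ , e∈C₄ , C₄⊆C₂∪C₃-g) =
      let C₅ , cC₅ , f∈C₅ , C₅⊆C₁∪C₄-e =
            strong-circuit-elimination-below k ∣C₁∪C₄∣≤k cC₁ cC₄ e∈C₁ e∈C₄ f∈C₁ f∉C₄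
      in C₅ , cC₅ , f∈C₅ , λ x∈C₅ → C₁∪C₄-e⊆U-e (C₅⊆C₁∪C₄-e x∈C₅)
      where
      C₄⊆U-f-g : C₄ ⊆ (U - f) - g
      C₄⊆U-f-g x∈C₄ = let x∈C₂∪C₃ , x≢g = x∈p-y⁻ (C₂ ∪ C₃) (C₄⊆C₂∪C₃-g x∈C₄) in
        x∈p∧x≢y⇒x∈p-y (C₂∪C₃⊆U-f x∈C₂∪C₃) x≢g
      C₄⊆U : C₄ ⊆ U
      C₄⊆U x∈C₄ = proj₁ (x∈p-y⁻ U (proj₁ (x∈p-y⁻ (U - f) (C₄⊆U-f-g x∈C₄))))
      f∉C₄ : f ∉ C₄
      f∉C₄ f∈C₄ = x∉p-x U f (proj₁ (x∈p-y⁻ (U - f) (C₄⊆U-f-g f∈C₄)))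
      C₁∪C₄⊆U-g : C₁ ∪ C₄ ⊆ U - g
      C₁∪C₄⊆U-g {x} x∈ with x∈p∪q⁻ C₁ C₄ x∈
      ... | inj₁ x∈C₁ = x∈p∧x≢y⇒x∈p-y (p⊆p∪q C₂ x∈C₁) λ { refl → g∉C₁ x∈C₁ }
      ... | inj₂ x∈C₄ = x∈p∧x≢y⇒x∈p-y (C₄⊆U x∈C₄) (proj₂ (x∈p-y⁻ (U - f) (C₄⊆U-f-g x∈C₄)))
      ∣C₁∪C₄∣≤k = ≤-<-trans (p⊆q⇒∣p∣≤∣q∣ C₁∪C₄⊆U-g) (∣U-x∣<k (q⊆p∪q C₁ C₂ g∈C₂))
      C₁∪C₄-e⊆U-e : (C₁ ∪ C₄) - e ⊆ U - e
      C₁∪C₄-e⊆U-e = p─r⊆q─r λ x∈ _ → [ p⊆p∪q C₂ , C₄⊆U ]′ (x∈p∪q⁻ C₁ C₄ x∈)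

  strong-circuit-elimination : ∀ {C₁ C₂ e f} → Circuit C₁ → Circuit C₂ → e ∈ C₁ → e ∈ C₂ → f ∈ C₁ → f ∉ C₂ →
                               ∃[ C ] (Circuit C × f ∈ C × C ⊆ (C₁ ∪ C₂) - e)
  strong-circuit-elimination {C₁} {C₂} = strong-circuit-elimination-below (suc ∣ C₁ ∪ C₂ ∣) ≤-refl

  circuit-avoiding : ∀ {Y D e} → Circuit Y → Circuit D → Y ≢ D → e ∈ D → ∃[ C ] (Circuit C × C ⊆ (Y ∪ D) - e)
  circuit-avoiding {Y} {D} {e} cY cD Y≢D e∈D with e ∈? Y
  ... | yes e∈Y = circuit-elimination cY cD Y≢D e∈Y e∈D
  ... | no e∉Y = Y , cY , λ w∈Y → x∈p∧x≢y⇒x∈p-y (p⊆p∪q D w∈Y) λ { refl → e∉Y w∈Y }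

  dep-exchange : ∀ {D Y y d e} → Circuit D → e ∈ D → d ∈ D → y ∉ D → Circuit Y → Y ⊆ ⁅ y ⁆ ∪ (D - d) →
                 Dep (⁅ y ⁆ ∪ (D - e))
  dep-exchange {D} {Y} {y} {d} {e} cD e∈D d∈D y∉D cY Y⊆yD-d =
    let C , cC , C⊆YD-e = circuit-avoiding cY cD Y≢D e∈D in dep-⊇ (YD-e⊆yD-e ∘ C⊆YD-e) (proj₁ cC)
    where
    Y≢D : Y ≢ D
    Y≢D refl with x∈p∪q⁻ ⁅ y ⁆ (D - d) (Y⊆yD-d d∈D)
    ... | inj₁ d∈y = y∉D (subst (_∈ D) (x∈⁅y⁆⇒x≡y y d∈y) d∈D)
    ... | inj₂ d∈D-d = x∉p-x D d d∈D-d
    YD-e⊆yD-e : (Y ∪ D) - e ⊆ ⁅ y ⁆ ∪ (D - e)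
    YD-e⊆yD-e w∈ with x∈p-y⁻ (Y ∪ D) w∈
    ... | w∈YD , w≢e with x∈p∪q⁻ Y D w∈YD
    ... | inj₂ w∈D = q⊆p∪q ⁅ y ⁆ _ (x∈p∧x≢y⇒x∈p-y w∈D w≢e)
    ... | inj₁ w∈Y with x∈p∪q⁻ ⁅ y ⁆ (D - d) (Y⊆yD-d w∈Y)
    ... | inj₁ w∈y = p⊆p∪q _ w∈y
    ... | inj₂ w∈D-d = q⊆p∪q ⁅ y ⁆ _ (x∈p∧x≢y⇒x∈p-y (proj₁ (x∈p-y⁻ D w∈D-d)) w≢e)

  indep⊆C⇒∣≤∣basis : ∀ {I J C} → I ⊆ C → Indep I → IsBasisOf M J C → ∣ I ∣ ≤ ∣ J ∣
  indep⊆C⇒∣≤∣basis {I} {J} I⊆C iI (J⊆C , iJ , J-maximal) with ∣ I ∣ ≤? ∣ J ∣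
  ... | yes ∣I∣≤∣J∣ = ∣I∣≤∣J∣
  ... | no ∣I∣≰∣J∣ =
    let h , h∈I , h∉J , ihJ = indep-aug M J I iJ iI (≰⇒> ∣I∣≰∣J∣)
    in ⊥-elim (indep⇒¬dep ihJ (J-maximal h (I⊆C h∈I) h∉J))

  basis-of-indep : ∀ {J C} → Indep C → IsBasisOf M J C → J ≡ C
  basis-of-indep {J} {C} iC bJ@(J⊆C , _ , _) =
    ⊆-antisym J⊆C (p⊆q∧∣q∣≤∣p∣⇒q⊆p J⊆C (indep⊆C⇒∣≤∣basis ⊆-refl iC bJ))

  indep⇒basis-of-itself : ∀ {C} → Indep C → IsBasisOf M C C
  indep⇒basis-of-itself iC = ⊆-refl , iC , λ _ c∈C c∉C → ⊥-elim (c∉C c∈C)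

  indepContract⇔indep-∪ : ∀ {C} Y → Indep C → (IndepContract M C Y ⇔ Indep (Y ∪ C))
  indepContract⇔indep-∪ {C} Y iC = mk⇔
    (λ (J , bJ , iYJ) → subst (λ J → Indep (Y ∪ J)) (basis-of-indep iC bJ) iYJ)
    (λ iYC → C , indep⇒basis-of-itself iC , iYC)

  -- Y ∪ J is spanned by a maximal independent K ⊆ Y ∪ J of size at least ∣ Y ∪ J′ ∣ ≥ ∣ Y ∪ J ∣.
  indep-∪-basis : ∀ {J J′ C Y} → IsBasisOf M J C → IsBasisOf M J′ C → Empty (Y ∩ C) →
                  Indep (Y ∪ J′) → Indep (Y ∪ J)
  indep-∪-basis {J} {J′} {C} {Y} bJ@(J⊆C , iJ , J-maximal) bJ′@(J′⊆C , iJ′ , _) Y∩C≡∅ iYJ′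
    with extend-to-maximal (Y ∪ J) J (q⊆p∪q Y J) iJ
  ... | K , J⊆K , K⊆YJ , iK , K-maximal = indep-⊆ (p⊆q∧∣q∣≤∣p∣⇒q⊆p K⊆YJ ∣YJ∣≤∣K∣) iK
    where
    disjoint : ∀ {A} → A ⊆ C → Empty (Y ∩ A)
    disjoint A⊆C (x , x∈) = let x∈Y , x∈A = x∈p∩q⁻ Y _ x∈ in Y∩C≡∅ (x , x∈p∩q⁺ (x∈Y , A⊆C x∈A))
    ∣YJ′∣≤∣K∣ : ∣ Y ∪ J′ ∣ ≤ ∣ K ∣
    ∣YJ′∣≤∣K∣ with ∣ Y ∪ J′ ∣ ≤? ∣ K ∣
    ... | yes ∣YJ′∣≤∣K∣ = ∣YJ′∣≤∣K∣
    ... | no ∣YJ′∣≰∣K∣ with indep-aug M K (Y ∪ J′) iK iYJ′ (≰⇒> ∣YJ′∣≰∣K∣)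
    ... | h , h∈YJ′ , h∉K , ihK with x∈p∪q⁻ Y J′ h∈YJ′
    ... | inj₁ h∈Y = ⊥-elim (indep⇒¬dep ihK (K-maximal h (p⊆p∪q J h∈Y) h∉K))
    ... | inj₂ h∈J′ = ⊥-elim (indep⇒¬dep (indep-⊆ hJ⊆hK ihK) (J-maximal h (J′⊆C h∈J′) (h∉K ∘ J⊆K)))
      where
      hJ⊆hK : ⁅ h ⁆ ∪ J ⊆ ⁅ h ⁆ ∪ K
      hJ⊆hK x∈ = [ p⊆p∪q K , q⊆p∪q ⁅ h ⁆ K ∘ J⊆K ]′ (x∈p∪q⁻ ⁅ h ⁆ J x∈)
    ∣YJ∣≤∣K∣ : ∣ Y ∪ J ∣ ≤ ∣ K ∣
    ∣YJ∣≤∣K∣ = begin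
      ∣ Y ∪ J ∣      ≡⟨ ∣p∪q∣≡∣p∣+∣q∣ Y J (disjoint J⊆C) ⟩
      ∣ Y ∣ + ∣ J ∣  ≤⟨ +-monoʳ-≤ ∣ Y ∣ (indep⊆C⇒∣≤∣basis J⊆C iJ bJ′) ⟩
      ∣ Y ∣ + ∣ J′ ∣ ≡⟨ ∣p∪q∣≡∣p∣+∣q∣ Y J′ (disjoint J′⊆C) ⟨
      ∣ Y ∪ J′ ∣     ≤⟨ ∣YJ′∣≤∣K∣ ⟩
      ∣ K ∣          ∎
      where open ≤-Reasoning

minor-sym : ∀ {M : Matroid n} {indN : Subset k → Bool} {e f} →
            HasMinorUsing M indN e f → HasMinorUsing M indN f e
minor-sym (C , S , C∩S≡∅ , e∈S , f∈S , rest) = C , S , C∩S≡∅ , f∈S , e∈S , rest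

module W₂Contraction {n : ℕ} (M : Matroid n) where
  open MatroidProperties M

  IndepMissing : Subset n → Fin n → Fin n → Set
  IndepMissing X u v = ∀ W → W ⊆ X → u ∉ W → v ∉ W → Indep W

  DepContaining₁ : Subset n → Fin n → Set
  DepContaining₁ X u = ∀ W → (∀ z → z ∈ X → z ≢ u → z ∈ W) → Dep W

  DepContaining₂ : Subset n → Fin n → Fin n → Set
  DepContaining₂ X u v = ∀ W → (∀ z → z ∈ X → z ≢ u → z ≢ v → z ∈ W) → Dep W

  -- Conditions, stated in M itself, for (M | X) / (X ∖ {a, b, c, d}) to be M(W₂) on a, b, c, d;
  -- each field is named after the set of M(W₂) it certifies.
  record ContractsToW₂ (X : Subset n) (a b c d : Fin n) : Set where
    field
      a≢b : a ≢ b
      a≢c : a ≢ c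
      a≢d : a ≢ d
      b≢c : b ≢ c
      b≢d : b ≢ d
      c≢d : c ≢ d
      a∈X : a ∈ X
      b∈X : b ∈ X
      c∈X : c ∈ X
      d∈X : d ∈ X
      indep-cd : IndepMissing X a b
      indep-bd : IndepMissing X a c
      indep-bc : IndepMissing X a d
      indep-ad : IndepMissing X b c
      indep-ac : IndepMissing X b d
      dep-ab : DepContaining₂ X c d
      dep-bcd : DepContaining₁ X a
      dep-acd : DepContaining₁ X b

  module _ {X : Subset n} {a b c d : Fin n} (W : ContractsToW₂ X a b c d) where
    open ContractsToW₂ W

    corner : Fin 4 → Fin n
    corner zero = a
    corner (suc zero) = b
    corner (suc (suc zero)) = c
    corner (suc (suc (suc zero))) = d

    corner-injective : Injective _≡_ _≡_ corner
    corner-injective {zero} {zero} _ = refl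
    corner-injective {zero} {suc zero} a≡b = ⊥-elim (a≢b a≡b)
    corner-injective {zero} {suc (suc zero)} a≡c = ⊥-elim (a≢c a≡c)
    corner-injective {zero} {suc (suc (suc zero))} a≡d = ⊥-elim (a≢d a≡d)
    corner-injective {suc zero} {zero} b≡a = ⊥-elim (a≢b (sym b≡a))
    corner-injective {suc zero} {suc zero} _ = refl
    corner-injective {suc zero} {suc (suc zero)} b≡c = ⊥-elim (b≢c b≡c)
    corner-injective {suc zero} {suc (suc (suc zero))} b≡d = ⊥-elim (b≢d b≡d)
    corner-injective {suc (suc zero)} {zero} c≡a = ⊥-elim (a≢c (sym c≡a))
    corner-injective {suc (suc zero)} {suc zero} c≡b = ⊥-elim (b≢c (sym c≡b))
    corner-injective {suc (suc zero)} {suc (suc zero)} _ = refl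
    corner-injective {suc (suc zero)} {suc (suc (suc zero))} c≡d = ⊥-elim (c≢d c≡d)
    corner-injective {suc (suc (suc zero))} {zero} d≡a = ⊥-elim (a≢d (sym d≡a))
    corner-injective {suc (suc (suc zero))} {suc zero} d≡b = ⊥-elim (b≢d (sym d≡b))
    corner-injective {suc (suc (suc zero))} {suc (suc zero)} d≡c = ⊥-elim (c≢d (sym d≡c))
    corner-injective {suc (suc (suc zero))} {suc (suc (suc zero))} _ = refl

    S : Subset n
    S = ⁅ a ⁆ ∪ (⁅ b ⁆ ∪ (⁅ c ⁆ ∪ ⁅ d ⁆))

    corner∈S : ∀ i → corner i ∈ S
    corner∈S zero = p⊆p∪q _ (x∈⁅x⁆ a)
    corner∈S (suc zero) = q⊆p∪q ⁅ a ⁆ _ (p⊆p∪q _ (x∈⁅x⁆ b))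
    corner∈S (suc (suc zero)) = q⊆p∪q ⁅ a ⁆ _ (q⊆p∪q ⁅ b ⁆ _ (p⊆p∪q _ (x∈⁅x⁆ c)))
    corner∈S (suc (suc (suc zero))) = q⊆p∪q ⁅ a ⁆ _ (q⊆p∪q ⁅ b ⁆ _ (q⊆p∪q ⁅ c ⁆ _ (x∈⁅x⁆ d)))

    S⊆corners : ∀ z → z ∈ S → ∃[ i ] corner i ≡ z
    S⊆corners z z∈S with x∈p∪q⁻ ⁅ a ⁆ _ z∈S
    ... | inj₁ z∈a = zero , sym (x∈⁅y⁆⇒x≡y a z∈a)
    ... | inj₂ z∈bcd with x∈p∪q⁻ ⁅ b ⁆ _ z∈bcd
    ... | inj₁ z∈b = suc zero , sym (x∈⁅y⁆⇒x≡y b z∈b)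
    ... | inj₂ z∈cd with x∈p∪q⁻ ⁅ c ⁆ ⁅ d ⁆ z∈cd
    ... | inj₁ z∈c = suc (suc zero) , sym (x∈⁅y⁆⇒x≡y c z∈c)
    ... | inj₂ z∈d = suc (suc (suc zero)) , sym (x∈⁅y⁆⇒x≡y d z∈d)

    S⊆X : S ⊆ X
    S⊆X {z} z∈S with S⊆corners z z∈S
    ... | zero , refl = a∈X
    ... | suc zero , refl = b∈X
    ... | suc (suc zero) , refl = c∈X
    ... | suc (suc (suc zero)) , refl = d∈X

    C : Subset n
    C = X ─ S

    C∩S≡∅ : Empty (C ∩ S)
    C∩S≡∅ (z , z∈) = let z∈C , z∈S = x∈p∩q⁻ C S z∈ in proj₂ (x∈p─q⁻ X S z∈C) z∈S

    indep-C : Indep C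
    indep-C = indep-cd C (p─q⊆p X S) (λ a∈C → C∩S≡∅ (a , x∈p∩q⁺ (a∈C , corner∈S zero)))
                                     (λ b∈C → C∩S≡∅ (b , x∈p∩q⁺ (b∈C , corner∈S (suc zero))))

    module _ {X′ : Subset 4} {Y : Subset n} (Y⊆S : Y ⊆ S) (X′≅Y : ∀ i → (i ∈ X′ ⇔ corner i ∈ Y)) where

      indep-∪C : ∀ {u v} → IndepMissing X (corner u) (corner v) → u ∉ X′ → v ∉ X′ → Indep (Y ∪ C)
      indep-∪C {u} {v} missing u∉X′ v∉X′ = missing (Y ∪ C) Y∪C⊆X (outside u u∉X′) (outside v v∉X′)
        where
        Y∪C⊆X : Y ∪ C ⊆ X
        Y∪C⊆X z∈ = [ S⊆X ∘ Y⊆S , p─q⊆p X S ]′ (x∈p∪q⁻ Y C z∈)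
        outside : ∀ i → i ∉ X′ → corner i ∉ Y ∪ C
        outside i i∉X′ z∈ with x∈p∪q⁻ Y C z∈
        ... | inj₁ z∈Y = i∉X′ (Equivalence.from (X′≅Y i) z∈Y)
        ... | inj₂ z∈C = C∩S≡∅ (corner i , x∈p∩q⁺ (z∈C , corner∈S i))

      covered : ∀ z → z ∈ X → (∀ i → corner i ≡ z → i ∈ X′) → z ∈ Y ∪ C
      covered z z∈X corners∈X′ with z ∈? S
      ... | yes z∈S = let i , i↦z = S⊆corners z z∈S in
                      p⊆p∪q C (subst (_∈ Y) i↦z (Equivalence.to (X′≅Y i) (corners∈X′ i i↦z)))
      ... | no z∉S = q⊆p∪q Y C (x∈p∧x∉q⇒x∈p─q z∈X z∉S)

    indepW₂≡indep-∪C : ∀ X′ Y → Y ⊆ S → (∀ i → (i ∈ X′ ⇔ corner i ∈ Y)) → indepW₂ X′ ≡ indep M (Y ∪ C)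
    indepW₂≡indep-∪C (true ∷ true ∷ _ ∷ _ ∷ []) Y Y⊆S X′≅Y =
      sym (dep-ab (Y ∪ C) λ z z∈X z≢c z≢d → covered Y⊆S X′≅Y z z∈X λ where
        zero _ → here
        (suc zero) _ → there here
        (suc (suc zero)) refl → ⊥-elim (z≢c refl)
        (suc (suc (suc zero))) refl → ⊥-elim (z≢d refl))
    indepW₂≡indep-∪C (true ∷ false ∷ true ∷ true ∷ []) Y Y⊆S X′≅Y =
      sym (dep-acd (Y ∪ C) λ z z∈X z≢b → covered Y⊆S X′≅Y z z∈X λ where
        zero _ → here
        (suc zero) refl → ⊥-elim (z≢b refl)
        (suc (suc zero)) _ → there (there here)
        (suc (suc (suc zero))) _ → there (there (there here)))
    indepW₂≡indep-∪C (false ∷ true ∷ true ∷ true ∷ []) Y Y⊆S X′≅Y =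
      sym (dep-bcd (Y ∪ C) λ z z∈X z≢a → covered Y⊆S X′≅Y z z∈X λ where
        zero refl → ⊥-elim (z≢a refl)
        (suc zero) _ → there here
        (suc (suc zero)) _ → there (there here)
        (suc (suc (suc zero))) _ → there (there (there here)))
    indepW₂≡indep-∪C (true ∷ false ∷ true ∷ false ∷ []) Y Y⊆S X′≅Y =
      sym (indep-∪C Y⊆S X′≅Y indep-ac (λ { (there ()) }) λ { (there (there (there ()))) })
    indepW₂≡indep-∪C (true ∷ false ∷ false ∷ true ∷ []) Y Y⊆S X′≅Y =
      sym (indep-∪C Y⊆S X′≅Y indep-ad (λ { (there ()) }) λ { (there (there ())) })
    indepW₂≡indep-∪C (true ∷ false ∷ false ∷ false ∷ []) Y Y⊆S X′≅Y =
      sym (indep-∪C Y⊆S X′≅Y indep-ad (λ { (there ()) }) λ { (there (there ())) })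
    indepW₂≡indep-∪C (false ∷ true ∷ true ∷ false ∷ []) Y Y⊆S X′≅Y =
      sym (indep-∪C Y⊆S X′≅Y indep-bc (λ ()) λ { (there (there (there ()))) })
    indepW₂≡indep-∪C (false ∷ true ∷ false ∷ true ∷ []) Y Y⊆S X′≅Y =
      sym (indep-∪C Y⊆S X′≅Y indep-bd (λ ()) λ { (there (there ())) })
    indepW₂≡indep-∪C (false ∷ true ∷ false ∷ false ∷ []) Y Y⊆S X′≅Y =
      sym (indep-∪C Y⊆S X′≅Y indep-bd (λ ()) λ { (there (there ())) })
    indepW₂≡indep-∪C (false ∷ false ∷ _ ∷ _ ∷ []) Y Y⊆S X′≅Y =
      sym (indep-∪C Y⊆S X′≅Y indep-cd (λ ()) λ { (there ()) })

    contractsToW₂⇒minor : ∀ i j → HasMinorUsing M indepW₂ (corner i) (corner j)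
    contractsToW₂⇒minor i j =
      C , S , C∩S≡∅ , corner∈S i , corner∈S j , corner , corner-injective , corner∈S , S⊆corners ,
      λ X′ Y Y⊆S X′≅Y → let indepW₂≡ = indepW₂≡indep-∪C X′ Y Y⊆S X′≅Y
                            indepContract⇔ = indepContract⇔indep-∪ Y indep-C in
        mk⇔ (λ iX′ → Equivalence.from indepContract⇔ (trans (sym indepW₂≡) iX′))
            (λ ic → trans indepW₂≡ (Equivalence.to indepContract⇔ ic))

  -- D ∪ D′ is a theta: D = P₁ ∪ P₂ and D′ = P₂ ∪ P₃ for three disjoint paths, so that the only
  -- circuit of D ∪ D′ missing a point of P₃ = D′ ∖ D is D.
  Theta : Subset n → Subset n → Set
  Theta D D′ = ∀ Z → Circuit Z → Z ⊆ D ∪ D′ → ∀ x → x ∈ D′ → x ∉ D → x ∉ Z → Z ≡ D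

  theta-sym : ∀ {D D′} → Circuit D → Circuit D′ → Theta D D′ → Theta D′ D
  theta-sym {D} {D′} cD cD′ θ Z cZ Z⊆D′∪D c c∈D c∉D′ c∉Z with Z ⊆? D′
  ... | yes Z⊆D′ = circuit⊆circuit⇒≡ cZ cD′ Z⊆D′
  ... | no Z⊈D′ with Z ⊆? D
  ... | yes Z⊆D = ⊥-elim (c∉Z (subst (c ∈_) (sym (circuit⊆circuit⇒≡ cZ cD Z⊆D)) c∈D))
  ... | no Z⊈D with ⊈⇒∃∈∖ Z⊈D
  ... | z , z∈Z , z∉D
    with circuit-elimination cZ cD′ (λ { refl → Z⊈D′ ⊆-refl }) z∈Z (x∈p∪q∧x∉q⇒x∈p (Z⊆D′∪D z∈Z) z∉D)
  ... | W , cW , W⊆Z∪D′-z =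
    ⊥-elim (c∉Z∪D′ (proj₁ (x∈p-y⁻ (Z ∪ D′) (W⊆Z∪D′-z (subst (c ∈_) (sym W≡D) c∈D)))))
    where
    W⊆D∪D′ : W ⊆ D ∪ D′
    W⊆D∪D′ x∈W with x∈p∪q⁻ Z D′ (proj₁ (x∈p-y⁻ (Z ∪ D′) (W⊆Z∪D′-z x∈W)))
    ... | inj₁ x∈Z = subst (_ ∈_) (∪-comm D′ D) (Z⊆D′∪D x∈Z)
    ... | inj₂ x∈D′ = q⊆p∪q D D′ x∈D′
    W≡D : W ≡ D
    W≡D = θ W cW W⊆D∪D′ z (x∈p∪q∧x∉q⇒x∈p (Z⊆D′∪D z∈Z) z∉D) z∉D (x∉p-x (Z ∪ D′) z ∘ W⊆Z∪D′-z)
    c∉Z∪D′ : c ∉ Z ∪ D′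
    c∉Z∪D′ c∈ = [ c∉Z , c∉D′ ]′ (x∈p∪q⁻ Z D′ c∈)

  theta⇒indepMissing : ∀ {D D′ x y} → Theta D D′ → x ∈ D′ → x ∉ D → y ∈ D → IndepMissing (D ∪ D′) x y
  theta⇒indepMissing θ x∈D′ x∉D y∈D W W⊆D∪D′ x∉W y∉W with indep⊎dep W
  ... | inj₁ iW = iW
  ... | inj₂ dW with dep⇒circuit⊆ W dW
  ... | Z , cZ , Z⊆W = ⊥-elim (y∉W (Z⊆W (subst (_ ∈_) (sym Z≡D) y∈D)))
    where
    Z≡D = θ Z cZ (W⊆D∪D′ ∘ Z⊆W) _ x∈D′ x∉D (x∉W ∘ Z⊆W)

  circuit⇒depContaining₂ : ∀ {D D′ u v} → Circuit D′ → u ∉ D′ → v ∉ D′ → DepContaining₂ (D ∪ D′) u v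
  circuit⇒depContaining₂ {D} cD′ u∉D′ v∉D′ W contains =
    dep-⊇ (λ {z} z∈D′ → contains z (q⊆p∪q D _ z∈D′) (λ { refl → u∉D′ z∈D′ }) (λ { refl → v∉D′ z∈D′ }))
          (proj₁ cD′)

  circuits⇒depContaining₁ : ∀ {D D′} → Circuit D → Circuit D′ → D ≢ D′ → ∀ w → DepContaining₁ (D ∪ D′) w
  circuits⇒depContaining₁ {D} {D′} cD cD′ D≢D′ w W contains with w ∈? D | w ∈? D′
  ... | no w∉D | _ = dep-⊇ (λ {z} z∈D → contains z (p⊆p∪q D′ z∈D) λ { refl → w∉D z∈D }) (proj₁ cD)
  ... | yes _ | no w∉D′ = dep-⊇ (λ {z} z∈D′ → contains z (q⊆p∪q D D′ z∈D′) λ { refl → w∉D′ z∈D′ }) (proj₁ cD′)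
  ... | yes w∈D | yes w∈D′ with circuit-elimination cD cD′ D≢D′ w∈D w∈D′
  ... | C , cC , C⊆D∪D′-w =
    dep-⊇ (λ z∈C → let z∈D∪D′ , z≢w = x∈p-y⁻ (D ∪ D′) (C⊆D∪D′-w z∈C) in contains _ z∈D∪D′ z≢w) (proj₁ cC)

  -- a sits on P₃, b on the shared path P₂ and c, d on P₁.
  theta⇒contractsToW₂ : ∀ {D D′ a b c d} → Circuit D → Circuit D′ → Theta D D′ →
                        a ∈ D′ → a ∉ D → b ∈ D → b ∈ D′ → c ∈ D → c ∉ D′ → d ∈ D → d ∉ D′ → c ≢ d →
                        ContractsToW₂ (D ∪ D′) a b c d
  theta⇒contractsToW₂ {D} {D′} cD cD′ θ a∈D′ a∉D b∈D b∈D′ c∈D c∉D′ d∈D d∉D′ c≢d = record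
    { a≢b = λ { refl → a∉D b∈D }
    ; a≢c = λ { refl → a∉D c∈D }
    ; a≢d = λ { refl → a∉D d∈D }
    ; b≢c = λ { refl → c∉D′ b∈D′ }
    ; b≢d = λ { refl → d∉D′ b∈D′ }
    ; c≢d = c≢d
    ; a∈X = q⊆p∪q D D′ a∈D′
    ; b∈X = p⊆p∪q D′ b∈D
    ; c∈X = p⊆p∪q D′ c∈D
    ; d∈X = p⊆p∪q D′ d∈D
    ; indep-cd = theta⇒indepMissing θ a∈D′ a∉D b∈D
    ; indep-bd = theta⇒indepMissing θ a∈D′ a∉D c∈D
    ; indep-bc = theta⇒indepMissing θ a∈D′ a∉D d∈D
    ; indep-ad = swap (theta⇒indepMissing′ c∈D c∉D′ b∈D′)
    ; indep-ac = swap (theta⇒indepMissing′ d∈D d∉D′ b∈D′)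
    ; dep-ab = circuit⇒depContaining₂ cD′ c∉D′ d∉D′
    ; dep-bcd = circuits⇒depContaining₁ cD cD′ D≢D′ _
    ; dep-acd = circuits⇒depContaining₁ cD cD′ D≢D′ _
    }
    where
    D≢D′ : D ≢ D′
    D≢D′ refl = a∉D a∈D′
    swap : ∀ {X u v} → IndepMissing X u v → IndepMissing X v u
    swap missing W W⊆X v∉W u∉W = missing W W⊆X u∉W v∉W
    theta⇒indepMissing′ : ∀ {x y} → x ∈ D → x ∉ D′ → y ∈ D′ → IndepMissing (D ∪ D′) x y
    theta⇒indepMissing′ x∈D x∉D′ y∈D′ =
      subst (λ X → IndepMissing X _ _) (∪-comm D′ D)
            (theta⇒indepMissing (theta-sym cD cD′ θ) x∈D x∉D′ y∈D′)

  theta⇒minor : ∀ {D D′ x e f} → Circuit D → Circuit D′ → Theta D D′ → x ∈ D′ → x ∉ D → Nonempty (D ∩ D′) →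
                e ∈ D → e ∉ D′ → f ∈ D → e ≢ f → (f ∈ D′ → ∃[ d ] (d ∈ D × d ∉ D′ × d ≢ e)) →
                HasMinorUsing M indepW₂ e f
  theta⇒minor {D} {D′} {f = f} cD cD′ θ x∈D′ x∉D (b , b∈D∩D′) e∈D e∉D′ f∈D e≢f another with f ∈? D′
  ... | yes f∈D′ = let d , d∈D , d∉D′ , d≢e = another f∈D′ in
    contractsToW₂⇒minor (theta⇒contractsToW₂ cD cD′ θ x∈D′ x∉D f∈D f∈D′ e∈D e∉D′ d∈D d∉D′ (d≢e ∘ sym))
                        (# 2) (# 1)
  ... | no f∉D′ = let b∈D , b∈D′ = x∈p∩q⁻ D D′ b∈D∩D′ in
    contractsToW₂⇒minor (theta⇒contractsToW₂ cD cD′ θ x∈D′ x∉D b∈D b∈D′ e∈D e∉D′ f∈D f∉D′ e≢f)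
                        (# 2) (# 3)

  single-element-theta : ∀ {D Y x} → Indep ⁅ x ⁆ → Circuit D → Circuit Y → x ∉ D → Y ⊆ ⁅ x ⁆ ∪ D →
                         Theta D Y × Nonempty (D ∩ Y)
  single-element-theta {D} {Y} {x} ix cD cY x∉D Y⊆xD = θ , D∩Y≢∅
    where
    θ : Theta D Y
    θ Z cZ Z⊆D∪Y x′ x′∈Y x′∉D x′∉Z = circuit⊆circuit⇒≡ cZ cD Z⊆D
      where
      Z⊆D : Z ⊆ D
      Z⊆D z∈Z with x∈p∪q⁻ D Y (Z⊆D∪Y z∈Z)
      ... | inj₁ z∈D = z∈D
      ... | inj₂ z∈Y with x∈p∪q⁻ ⁅ x ⁆ D (Y⊆xD z∈Y)
      ... | inj₂ z∈D = z∈D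
      ... | inj₁ z∈x = ⊥-elim (x′∉Z (subst (_∈ Z) (trans (x∈⁅y⁆⇒x≡y x z∈x) (sym x′≡x)) z∈Z))
        where
        x′≡x = x∈⁅y⁆⇒x≡y x (x∈p∪q∧x∉q⇒x∈p (Y⊆xD x′∈Y) x′∉D)
    D∩Y≢∅ : Nonempty (D ∩ Y)
    D∩Y≢∅ with Y ⊆? ⁅ x ⁆
    ... | yes Y⊆x = ⊥-elim (indep⇒¬dep (indep-⊆ Y⊆x ix) (proj₁ cY))
    ... | no Y⊈x = let y , y∈Y , y∉x = ⊈⇒∃∈∖ Y⊈x in y , x∈p∩q⁺ (x∈p∪q∧x∉p⇒x∈q (Y⊆xD y∈Y) y∉x , y∈Y)

module Ears {n : ℕ} (M : Matroid n) where
  open MatroidProperties M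
  open W₂Contraction M

  -- For a circuit D, whose closure is that of D - d for each d ∈ D, this says y ∉ cl(D).
  Unspanned : Subset n → Fin n → Set
  Unspanned D y = ∀ d → d ∈ D → Indep (⁅ y ⁆ ∪ (D - d))

  unspanned? : ∀ D y → Dec (Unspanned D y)
  unspanned? D y = all? (λ d → (d ∈? D) →-dec (indep M (⁅ y ⁆ ∪ (D - d)) ≟ᵇ true))

  ¬unspanned⇒dep : ∀ {D y} → ¬ Unspanned D y → ∃[ d ] (d ∈ D × Dep (⁅ y ⁆ ∪ (D - d)))
  ¬unspanned⇒dep {D} {y} ¬unspanned with any? (λ d → (d ∈? D) ×-dec (indep M (⁅ y ⁆ ∪ (D - d)) ≟ᵇ false))
  ... | yes dependent = dependent
  ... | no ∄dependent = ⊥-elim (¬unspanned λ d d∈D → ¬-not λ dep → ∄dependent (d , d∈D , dep))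

  Ear : Subset n → Subset n → Set
  Ear D Z = Circuit Z × Nonempty (Z ∩ D) × ∃[ y ] (y ∈ Z × y ∉ D × Unspanned D y)

  ear? : ∀ D Z → Dec (Ear D Z)
  ear? D Z = circuit? Z ×-dec (nonempty? (Z ∩ D) ×-dec
    any? (λ y → (y ∈? Z) ×-dec (¬? (y ∈? D) ×-dec unspanned? D y)))

  MinimalEar : Subset n → Subset n → Set
  MinimalEar D = Minimum (Ear D) (λ Z → ∣ Z ─ D ∣)

  circuit-meets : ∀ {D Z W z} → Circuit Z → Circuit W → (∀ {w} → w ∈ W → w ∉ D → w ∈ Z) →
                  z ∈ Z → z ∉ W → Nonempty (W ∩ D)
  circuit-meets {D} {Z} {W} cZ cW W∖D⊆Z z∈Z z∉W with nonempty? (W ∩ D)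
  ... | yes W∩D≢∅ = W∩D≢∅
  ... | no W∩D≡∅ = ⊥-elim (z∉W (subst (_ ∈_) (sym (circuit⊆circuit⇒≡ cW cZ W⊆Z)) z∈Z))
    where
    W⊆Z : W ⊆ Z
    W⊆Z {w} w∈W = W∖D⊆Z w∈W λ w∈D → W∩D≡∅ (w , x∈p∩q⁺ (w∈W , w∈D))

  ∣─D∣-mono : ∀ {D W Z : Subset n} → (∀ {w} → w ∈ W → w ∉ D → w ∈ Z) → ∣ W ─ D ∣ ≤ ∣ Z ─ D ∣
  ∣─D∣-mono W∖D⊆Z = p⊆q⇒∣p∣≤∣q∣ (p─r⊆q─r W∖D⊆Z)

  ∣─D∣-mono-< : ∀ {D W Z : Subset n} {z} → (∀ {w} → w ∈ W → w ∉ D → w ∈ Z) → z ∈ Z → z ∉ D → z ∉ W →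
                ∣ W ─ D ∣ < ∣ Z ─ D ∣
  ∣─D∣-mono-< {W = W} W∖D⊆Z z∈Z z∉D z∉W =
    ⊆∧∈∖⇒∣p∣<∣q∣ (p─r⊆q─r W∖D⊆Z) (x∈p∧x∉q⇒x∈p─q z∈Z z∉D) (z∉W ∘ proj₁ ∘ x∈p─q⁻ W _)

  -- Otherwise eliminating z from the ear and a circuit of ⁅ z ⁆ ∪ (D - d) keeping its unspanned
  -- point gives an ear that has lost z.
  minimalEar⇒unspanned : ∀ {D Z z} → Circuit D → MinimalEar D Z → z ∈ Z → z ∉ D → Unspanned D z
  minimalEar⇒unspanned {D} {Z} {z} cD ((cZ , _ , y , y∈Z , y∉D , unspanned-y) , minimal) z∈Z z∉D
    with unspanned? D z
  ... | yes unspanned-z = unspanned-z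
  ... | no ¬unspanned-z with ¬unspanned⇒dep ¬unspanned-z
  ... | d , d∈D , dep with dep⇒circuit⊆ _ dep
  ... | Y , cY , Y⊆zD-d with z ∈? Y
  ... | no z∉Y = ⊥-elim (indep⇒¬dep (indep-⊆ Y⊆D-d (proj₂ cD d d∈D)) (proj₁ cY))
    where
    Y⊆D-d : Y ⊆ D - d
    Y⊆D-d w∈Y = x∈p∪q∧x∉p⇒x∈q (Y⊆zD-d w∈Y) λ w∈z → z∉Y (subst (_∈ Y) (x∈⁅y⁆⇒x≡y z w∈z) w∈Y)
  ... | yes z∈Y with strong-circuit-elimination cZ cY z∈Z z∈Y y∈Z y∉Y
    where
    y∉Y : y ∉ Y
    y∉Y y∈Y with x∈p∪q⁻ ⁅ z ⁆ (D - d) (Y⊆zD-d y∈Y)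
    ... | inj₁ y∈z = ¬unspanned-z (subst (Unspanned D) (x∈⁅y⁆⇒x≡y z y∈z) unspanned-y)
    ... | inj₂ y∈D-d = y∉D (proj₁ (x∈p-y⁻ D y∈D-d))
  ... | W , cW , y∈W , W⊆ZY-z = ⊥-elim (≤⇒≯ (minimal W ear-W) (∣─D∣-mono-< W∖D⊆Z z∈Z z∉D z∉W))
    where
    z∉W : z ∉ W
    z∉W = x∉p-x (Z ∪ Y) z ∘ W⊆ZY-z
    W∖D⊆Z : ∀ {w} → w ∈ W → w ∉ D → w ∈ Z
    W∖D⊆Z w∈W w∉D with x∈p-y⁻ (Z ∪ Y) (W⊆ZY-z w∈W)
    ... | w∈ZY , w≢z with x∈p∪q⁻ Z Y w∈ZY
    ... | inj₁ w∈Z = w∈Z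
    ... | inj₂ w∈Y with x∈p∪q⁻ ⁅ z ⁆ (D - d) (Y⊆zD-d w∈Y)
    ... | inj₁ w∈z = ⊥-elim (w≢z (x∈⁅y⁆⇒x≡y z w∈z))
    ... | inj₂ w∈D-d = ⊥-elim (w∉D (proj₁ (x∈p-y⁻ D w∈D-d)))
    ear-W : Ear D W
    ear-W = cW , circuit-meets cZ cW W∖D⊆Z z∈Z z∉W , y , y∈W , y∉D , unspanned-y

  minimalEar-avoiding : ∀ {D Z e} → Circuit D → e ∈ D → MinimalEar D Z → ∃[ Z′ ] (MinimalEar D Z′ × e ∉ Z′)
  minimalEar-avoiding {D} {Z} {e} cD e∈D minZ@((cZ , _ , y , y∈Z , y∉D , _) , minimal) with e ∈? Z
  ... | no e∉Z = Z , minZ , e∉Z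
  ... | yes e∈Z with circuit-elimination cD cZ (λ { refl → y∉D y∈Z }) e∈D e∈Z
  ... | W , cW , W⊆DZ-e = W , (ear-W , λ Z′ ear-Z′ → ≤-trans (∣─D∣-mono W∖D⊆Z) (minimal Z′ ear-Z′)) , e∉W
    where
    e∉W : e ∉ W
    e∉W = x∉p-x (D ∪ Z) e ∘ W⊆DZ-e
    W∖D⊆Z : ∀ {w} → w ∈ W → w ∉ D → w ∈ Z
    W∖D⊆Z w∈W = x∈p∪q∧x∉p⇒x∈q (proj₁ (x∈p-y⁻ (D ∪ Z) (W⊆DZ-e w∈W)))
    W⊈D : ¬ W ⊆ D
    W⊈D W⊆D = e∉W (subst (e ∈_) (sym (circuit⊆circuit⇒≡ cW cD W⊆D)) e∈D)
    ear-W : Ear D W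
    ear-W with ⊈⇒∃∈∖ W⊈D
    ... | w , w∈W , w∉D = cW , circuit-meets cZ cW W∖D⊆Z e∈Z e∉W , w , w∈W , w∉D ,
                          minimalEar⇒unspanned cD minZ (W∖D⊆Z w∈W w∉D) w∉D

  minimalEar⇒theta : ∀ {D Z} → Circuit D → MinimalEar D Z → Theta D Z
  minimalEar⇒theta {D} {Z} cD minZ@((cZ , _) , minimal) W cW W⊆D∪Z x x∈Z x∉D x∉W with W ⊆? D
  ... | yes W⊆D = circuit⊆circuit⇒≡ cW cD W⊆D
  ... | no W⊈D with ⊈⇒∃∈∖ W⊈D
  ... | w , w∈W , w∉D = ⊥-elim (≤⇒≯ (minimal W ear-W) (∣─D∣-mono-< W∖D⊆Z x∈Z x∉D x∉W))
    where
    W∖D⊆Z : ∀ {v} → v ∈ W → v ∉ D → v ∈ Z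
    W∖D⊆Z v∈W = x∈p∪q∧x∉p⇒x∈q (W⊆D∪Z v∈W)
    ear-W : Ear D W
    ear-W = cW , circuit-meets cZ cW W∖D⊆Z x∈Z x∉W , w , w∈W , w∉D ,
            minimalEar⇒unspanned cD minZ (W∖D⊆Z w∈W w∉D) w∉D

  -- If y were the only point of Z outside D, then Z ⊆ ⁅ y ⁆ ∪ (D - d) for any d ∈ D ∖ Z.
  unspanned⇒second-point : ∀ {D Z y} → Circuit D → Circuit Z → y ∈ Z → y ∉ D → Unspanned D y →
                            ∃[ z ] (z ∈ Z × z ∉ D × z ≢ y)
  unspanned⇒second-point {D} {Z} {y} cD cZ y∈Z y∉D unspanned
    with any? (λ z → (z ∈? Z) ×-dec (¬? (z ∈? D) ×-dec ¬? (z ≟ᶠ y)))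
  ... | yes second = second
  ... | no ∄second with D ⊆? Z
  ... | yes D⊆Z = ⊥-elim (y∉D (subst (y ∈_) (sym (circuit⊆circuit⇒≡ cD cZ D⊆Z)) y∈Z))
  ... | no D⊈Z with ⊈⇒∃∈∖ D⊈Z
  ... | d , d∈D , d∉Z = ⊥-elim (indep⇒¬dep (indep-⊆ Z⊆yD-d (unspanned d d∈D)) (proj₁ cZ))
    where
    Z⊆yD-d : Z ⊆ ⁅ y ⁆ ∪ (D - d)
    Z⊆yD-d {z} z∈Z with z ∈? D | z ≟ᶠ y
    ... | yes z∈D | _ = q⊆p∪q ⁅ y ⁆ _ (x∈p∧x≢y⇒x∈p-y z∈D λ { refl → d∉Z z∈Z })
    ... | no _ | yes refl = p⊆p∪q _ (x∈⁅x⁆ z)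
    ... | no z∉D | no z≢y = ⊥-elim (∄second (z , z∈Z , z∉D , z≢y))

  minimalEar⇒minor : ∀ {D Z e f} → Circuit D → e ∈ D → f ∈ D → e ≢ f → MinimalEar D Z → e ∉ Z →
                     HasMinorUsing M indepW₂ e f
  minimalEar⇒minor {D} {Z} {e} {f} cD e∈D f∈D e≢f
                   minZ@((cZ , Z∩D≢∅ , y , y∈Z , y∉D , unspanned) , _) e∉Z
    with unspanned⇒second-point cD cZ y∈Z y∉D unspanned | f ∈? Z
  ... | z , z∈Z , z∉D , z≢y | yes f∈Z =
    contractsToW₂⇒minor (theta⇒contractsToW₂ cZ cD (theta-sym cD cZ θ) e∈D e∉Z f∈Z f∈D y∈Z y∉D z∈Z z∉D (z≢y ∘ sym))
                        (# 0) (# 1)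
    where
    θ = minimalEar⇒theta cD minZ
  ... | _ | no f∉Z =
    theta⇒minor cD cZ (minimalEar⇒theta cD minZ) y∈Z y∉D D∩Z≢∅ e∈D e∉Z f∈D e≢f (⊥-elim ∘ f∉Z)
    where
    D∩Z≢∅ : Nonempty (D ∩ Z)
    D∩Z≢∅ = let x , x∈ = Z∩D≢∅ ; x∈Z , x∈D = x∈p∩q⁻ Z D x∈ in x , x∈p∩q⁺ (x∈D , x∈Z)

  ear⇒minor : ∀ {D Z e f} → Circuit D → e ∈ D → f ∈ D → e ≢ f → Ear D Z → HasMinorUsing M indepW₂ e f
  ear⇒minor {D} {Z} cD e∈D f∈D e≢f ear-Z with minimum (ear? D) (λ Z → ∣ Z ─ D ∣) Z ear-Z
  ... | Z₁ , minZ₁ with minimalEar-avoiding cD e∈D minZ₁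
  ... | Z₂ , minZ₂ , e∉Z₂ = minimalEar⇒minor cD e∈D f∈D e≢f minZ₂ e∉Z₂

module Sufficiency {n : ℕ} (M : Matroid n) (connected : Connected M) (nonuniform : ¬ Uniform M) where
  open MatroidProperties M
  open W₂Contraction M
  open Ears M

  indep-point : ∀ {x y} → x ≢ y → Indep ⁅ x ⁆
  indep-point {x} {y} x≢y with connected x y x≢y
  ... | C , cC , x∈C , y∈C = indep-⊆ x⊆C-y (proj₂ cC y y∈C)
    where
    x⊆C-y : ⁅ x ⁆ ⊆ C - y
    x⊆C-y z∈x with x∈⁅y⁆⇒x≡y x z∈x
    ... | refl = x∈p∧x≢y⇒x∈p-y x∈C x≢y

  CircuitThrough : Fin n → Fin n → Subset n → Set
  CircuitThrough e f D = Circuit D × e ∈ D × f ∈ D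

  circuitThrough? : ∀ e f D → Dec (CircuitThrough e f D)
  circuitThrough? e f D = circuit? D ×-dec ((e ∈? D) ×-dec (f ∈? D))

  module _ {e f : Fin n} (e≢f : e ≢ f) (earless : ¬ (∃[ D ] (CircuitThrough e f D × ∃ (Ear D)))) where

    spanned : ∀ {D y} → CircuitThrough e f D → y ∉ D → ∃[ d ] (d ∈ D × Dep (⁅ y ⁆ ∪ (D - d)))
    spanned {D} {y} through@(_ , e∈D , _) y∉D with unspanned? D y
    ... | no ¬unspanned = ¬unspanned⇒dep ¬unspanned
    ... | yes unspanned with connected y e (λ { refl → y∉D e∈D })
    ... | Z , cZ , y∈Z , e∈Z =
      ⊥-elim (earless (D , through , Z , cZ , (e , x∈p∩q⁺ (e∈Z , e∈D)) , y , y∈Z , y∉D , unspanned))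

    spanning : ∀ {D y} → CircuitThrough e f D → y ∉ D - e → Dep (⁅ y ⁆ ∪ (D - e))
    spanning {D} {y} through@(cD , e∈D , _) y∉D-e with y ≟ᶠ e
    ... | yes refl = dep-⊇ D⊆yD-y (proj₁ cD)
      where
      D⊆yD-y : D ⊆ ⁅ y ⁆ ∪ (D - y)
      D⊆yD-y {w} w∈D with w ≟ᶠ y
      ... | yes refl = p⊆p∪q _ (x∈⁅x⁆ w)
      ... | no w≢y = q⊆p∪q ⁅ y ⁆ _ (x∈p∧x≢y⇒x∈p-y w∈D w≢y)
    ... | no y≢e =
      let y∉D = λ y∈D → y∉D-e (x∈p∧x≢y⇒x∈p-y y∈D y≢e)
          d , d∈D , dep = spanned through y∉D
          Y , cY , Y⊆yD-d = dep⇒circuit⊆ _ dep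
      in dep-exchange cD e∈D d∈D y∉D cY Y⊆yD-d

    rank-bound : ∀ {D I} → CircuitThrough e f D → Indep I → ∣ I ∣ ≤ ∣ D - e ∣
    rank-bound {D} {I} through@(cD , e∈D , _) iI with ∣ I ∣ ≤? ∣ D - e ∣
    ... | yes ∣I∣≤ = ∣I∣≤
    ... | no ∣I∣≰ = let h , _ , h∉D-e , ihD-e = indep-aug M (D - e) I (proj₂ cD e e∈D) iI (≰⇒> ∣I∣≰)
                    in ⊥-elim (indep⇒¬dep ihD-e (spanning through h∉D-e))

    large⇒dep : ∀ {D T} → CircuitThrough e f D → ∣ D - e ∣ < ∣ T ∣ → Dep T
    large⇒dep {T = T} through ∣T∣> with indep⊎dep T
    ... | inj₁ iT = ⊥-elim (≤⇒≯ (rank-bound through iT) ∣T∣>)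
    ... | inj₂ dT = dT

    small-circuit : ∀ {D} → CircuitThrough e f D → ∃[ Q ] (Circuit Q × ∣ Q ∣ ≤ ∣ D - e ∣)
    small-circuit {D} through with anySubset? (λ X → (indep M X ≟ᵇ false) ×-dec (∣ X ∣ ≤? ∣ D - e ∣))
    ... | yes (X , dX , ∣X∣≤) = let Q , cQ , Q⊆X = dep⇒circuit⊆ X dX in Q , cQ , ≤-trans (p⊆q⇒∣p∣≤∣q∣ Q⊆X) ∣X∣≤
    ... | no ∄small = ⊥-elim (nonuniform (∣ D - e ∣ , λ X → mk⇔ (rank-bound through) λ ∣X∣≤ →
                        ¬-not λ dX → ∄small (X , dX , ∣X∣≤)))

    ClosestTo : Subset n → Subset n → Set
    ClosestTo Q = Minimum (CircuitThrough e f) (λ D → ∣ Q ─ D ∣)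

    -- ⁅ x ⁆ ∪ (D - d) is too large to be independent; a circuit Y in it passing through e and f
    -- would be the whole set and hence closer to Q than D.
    minor-by-exchange : ∀ {Q D x d} → ClosestTo Q D → x ∈ Q → x ∉ D → d ∈ D → d ∉ Q → d ≢ e → d ≢ f →
                        HasMinorUsing M indepW₂ e f
    minor-by-exchange {Q} {D} {x} {d} (through@(cD , e∈D , f∈D) , closest) x∈Q x∉D d∈D d∉Q d≢e d≢f
      with dep⇒circuit⊆ (⁅ x ⁆ ∪ (D - d)) (large⇒dep through (≤-reflexive (sym ∣T∣≡)))
      where
      ∣T∣≡ = ∣⁅x⁆∪p-y∣≡1+∣p-z∣ D x∉D d∈D e∈D
    ... | Y , cY , Y⊆xD-d with single-element-theta (indep-point x≢e) cD cY x∉D Y⊆xD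
      where
      x≢e : x ≢ e
      x≢e refl = x∉D e∈D
      Y⊆xD : Y ⊆ ⁅ x ⁆ ∪ D
      Y⊆xD y∈Y = [ p⊆p∪q D , q⊆p∪q ⁅ x ⁆ D ∘ proj₁ ∘ x∈p-y⁻ D ]′ (x∈p∪q⁻ ⁅ x ⁆ (D - d) (Y⊆xD-d y∈Y))
    ... | θ , D∩Y≢∅ with x ∈? Y | e ∈? Y | f ∈? Y
    ... | no x∉Y | _ | _ = ⊥-elim (indep⇒¬dep (indep-⊆ Y⊆D-d (proj₂ cD d d∈D)) (proj₁ cY))
      where
      Y⊆D-d : Y ⊆ D - d
      Y⊆D-d y∈Y = x∈p∪q∧x∉p⇒x∈q (Y⊆xD-d y∈Y) λ y∈x → x∉Y (subst (_∈ Y) (x∈⁅y⁆⇒x≡y x y∈x) y∈Y)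
    ... | yes x∈Y | no e∉Y | _ =
      theta⇒minor cD cY θ x∈Y x∉D D∩Y≢∅ e∈D e∉Y f∈D e≢f λ _ → d , d∈D , d∉Y , d≢e
      where
      d∉Y : d ∉ Y
      d∉Y = x∉⁅y⁆∪p-x (λ { refl → x∉D d∈D }) ∘ Y⊆xD-d
    ... | yes x∈Y | yes _ | no f∉Y =
      minor-sym {M = M} (theta⇒minor cD cY θ x∈Y x∉D D∩Y≢∅ f∈D f∉Y e∈D (e≢f ∘ sym)
                                     λ _ → d , d∈D , d∉Y , d≢f)
      where
      d∉Y : d ∉ Y
      d∉Y = x∉⁅y⁆∪p-x (λ { refl → x∉D d∈D }) ∘ Y⊆xD-d
    ... | yes x∈Y | yes e∈Y | yes f∈Y = ⊥-elim (≤⇒≯ (closest Y (cY , e∈Y , f∈Y)) ∣Q─Y∣<∣Q─D∣)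
      where
      ∣T∣≤∣Y∣ : ∣ ⁅ x ⁆ ∪ (D - d) ∣ ≤ ∣ Y ∣
      ∣T∣≤∣Y∣ = begin
        ∣ ⁅ x ⁆ ∪ (D - d) ∣ ≡⟨ ∣⁅x⁆∪p-y∣≡1+∣p-z∣ D x∉D d∈D e∈D ⟩
        suc ∣ D - e ∣       ≤⟨ s≤s (rank-bound (cY , e∈Y , f∈Y) (proj₂ cD e e∈D)) ⟩
        suc ∣ Y - e ∣       ≡⟨ 1+∣p-x∣≡∣p∣ Y e∈Y ⟩
        ∣ Y ∣               ∎
        where open ≤-Reasoning
      T⊆Y : ⁅ x ⁆ ∪ (D - d) ⊆ Y
      T⊆Y = p⊆q∧∣q∣≤∣p∣⇒q⊆p Y⊆xD-d ∣T∣≤∣Y∣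
      ∣Q─Y∣<∣Q─D∣ : ∣ Q ─ Y ∣ < ∣ Q ─ D ∣
      ∣Q─Y∣<∣Q─D∣ =
        ⊆∧∈∖⇒∣p∣<∣q∣ Q─Y⊆Q─D (x∈p∧x∉q⇒x∈p─q x∈Q x∉D) λ x∈Q─Y → proj₂ (x∈p─q⁻ Q Y x∈Q─Y) x∈Y
        where
        Q─Y⊆Q─D : Q ─ Y ⊆ Q ─ D
        Q─Y⊆Q─D q∈ with x∈p─q⁻ Q Y q∈
        ... | q∈Q , q∉Y = x∈p∧x∉q⇒x∈p─q q∈Q λ q∈D →
          q∉Y (T⊆Y (q⊆p∪q ⁅ x ⁆ _ (x∈p∧x≢y⇒x∈p-y q∈D λ { refl → d∉Q q∈Q })))

    -- Every set of size ∣ D ∣ is dependent, so Q, being smaller, misses e and f and has no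
    -- point outside ⁅ x ⁆ ∪ D; then D and Q form a theta.
    minor-by-containment : ∀ {Q D x} → CircuitThrough e f D → Circuit Q → ∣ Q ∣ ≤ ∣ D - e ∣ → x ∈ Q → x ∉ D →
                           (∀ w → w ∈ D → w ≢ e → w ≢ f → w ∈ Q) → HasMinorUsing M indepW₂ e f
    minor-by-containment {Q} {D} {x} (cD , e∈D , f∈D) cQ ∣Q∣≤ x∈Q x∉D D∖ef⊆Q =
      let θ , D∩Q≢∅ = single-element-theta (indep-point x≢e) cD cQ x∉D Q⊆xD
      in theta⇒minor cD cQ θ x∈Q x∉D D∩Q≢∅ e∈D e∉Q f∈D e≢f (⊥-elim ∘ f∉Q)
      where
      x≢e : x ≢ e
      x≢e refl = x∉D e∈D
      too-large : ∀ {T} → T ⊆ Q → ¬ ∣ T ∣ ≡ suc ∣ D - e ∣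
      too-large T⊆Q ∣T∣≡ = ≤⇒≯ ∣Q∣≤ (subst (_≤ ∣ Q ∣) ∣T∣≡ (p⊆q⇒∣p∣≤∣q∣ T⊆Q))
      xD-u⊆Q : ∀ {u v} → v ∈ Q → u ≢ v → (∀ w → w ∈ D → w ≢ u → w ≢ v → w ∈ Q) → ⁅ x ⁆ ∪ (D - u) ⊆ Q
      xD-u⊆Q {u} {v} v∈Q u≢v D∖uv⊆Q {w} w∈ with x∈p∪q⁻ ⁅ x ⁆ (D - u) w∈
      ... | inj₁ w∈x = subst (_∈ Q) (sym (x∈⁅y⁆⇒x≡y x w∈x)) x∈Q
      ... | inj₂ w∈D-u with x∈p-y⁻ D w∈D-u | w ≟ᶠ v
      ... | _ | yes refl = v∈Q
      ... | w∈D , w≢u | no w≢v = D∖uv⊆Q w w∈D w≢u w≢v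
      e∉Q : e ∉ Q
      e∉Q e∈Q = too-large (xD-u⊆Q e∈Q (e≢f ∘ sym) λ w w∈D w≢f w≢e → D∖ef⊆Q w w∈D w≢e w≢f)
                          (∣⁅x⁆∪p-y∣≡1+∣p-z∣ D x∉D f∈D e∈D)
      f∉Q : f ∉ Q
      f∉Q f∈Q = too-large (xD-u⊆Q f∈Q e≢f D∖ef⊆Q) (∣⁅x⁆∪p-y∣≡1+∣p-z∣ D x∉D e∈D e∈D)
      Q⊆xD : Q ⊆ ⁅ x ⁆ ∪ D
      Q⊆xD {q} q∈Q with q ∈? D | q ≟ᶠ x
      ... | yes q∈D | _ = q⊆p∪q ⁅ x ⁆ D q∈D
      ... | no _ | yes refl = p⊆p∪q D (x∈⁅x⁆ q)
      ... | no q∉D | no q≢x = ⊥-elim (too-large qxR⊆Q ∣qxR∣≡)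
        where
        R = (D - e) - f
        R⁻ : ∀ {w} → w ∈ R → w ∈ D × w ≢ e × w ≢ f
        R⁻ w∈R = let w∈D-e , w≢f = x∈p-y⁻ (D - e) w∈R ; w∈D , w≢e = x∈p-y⁻ D w∈D-e in w∈D , w≢e , w≢f
        ∣qxR∣≡ : ∣ ⁅ q ⁆ ∪ (⁅ x ⁆ ∪ R) ∣ ≡ suc ∣ D - e ∣
        ∣qxR∣≡ = begin
          ∣ ⁅ q ⁆ ∪ (⁅ x ⁆ ∪ R) ∣ ≡⟨ ∣⁅x⁆∪p∣≡1+∣p∣ (⁅ x ⁆ ∪ R) q∉xR ⟩
          suc ∣ ⁅ x ⁆ ∪ R ∣       ≡⟨ cong suc (∣⁅x⁆∪p∣≡1+∣p∣ R (x∉D ∘ proj₁ ∘ R⁻)) ⟩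
          suc (suc ∣ R ∣)         ≡⟨ cong suc (1+∣p-x∣≡∣p∣ (D - e) (x∈p∧x≢y⇒x∈p-y f∈D (e≢f ∘ sym))) ⟩
          suc ∣ D - e ∣           ∎
          where
          open ≡-Reasoning
          q∉xR : q ∉ ⁅ x ⁆ ∪ R
          q∉xR q∈ = [ q≢x ∘ x∈⁅y⁆⇒x≡y x , q∉D ∘ proj₁ ∘ R⁻ ]′ (x∈p∪q⁻ ⁅ x ⁆ R q∈)
        qxR⊆Q : ⁅ q ⁆ ∪ (⁅ x ⁆ ∪ R) ⊆ Q
        qxR⊆Q {w} w∈ with x∈p∪q⁻ ⁅ q ⁆ _ w∈
        ... | inj₁ w∈q = subst (_∈ Q) (sym (x∈⁅y⁆⇒x≡y q w∈q)) q∈Q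
        ... | inj₂ w∈xR with x∈p∪q⁻ ⁅ x ⁆ R w∈xR
        ... | inj₁ w∈x = subst (_∈ Q) (sym (x∈⁅y⁆⇒x≡y x w∈x)) x∈Q
        ... | inj₂ w∈R = let w∈D , w≢e , w≢f = R⁻ w∈R in D∖ef⊆Q w w∈D w≢e w≢f

    closest⇒minor : ∀ {Q D} → Circuit Q → ∣ Q ∣ ≤ ∣ D - e ∣ → ClosestTo Q D → HasMinorUsing M indepW₂ e f
    closest⇒minor {Q} {D} cQ ∣Q∣≤ closestD@((cD , e∈D , f∈D) , _) with Q ⊆? D
    ... | yes Q⊆D = ⊥-elim (≤⇒≯ (subst (λ Q → ∣ Q ∣ ≤ ∣ D - e ∣) (circuit⊆circuit⇒≡ cQ cD Q⊆D) ∣Q∣≤)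
                                   (≤-reflexive (1+∣p-x∣≡∣p∣ D e∈D)))
    ... | no Q⊈D with ⊈⇒∃∈∖ Q⊈D
    ... | x , x∈Q , x∉D
      with any? (λ d → (d ∈? D) ×-dec (¬? (d ∈? Q) ×-dec (¬? (d ≟ᶠ e) ×-dec ¬? (d ≟ᶠ f))))
    ... | yes (d , d∈D , d∉Q , d≢e , d≢f) = minor-by-exchange closestD x∈Q x∉D d∈D d∉Q d≢e d≢f
    ... | no ∄d = minor-by-containment (cD , e∈D , f∈D) cQ ∣Q∣≤ x∈Q x∉D λ w w∈D w≢e w≢f →
                    decidable-stable (w ∈? Q) λ w∉Q → ∄d (w , w∈D , w∉Q , w≢e , w≢f)

    earless⇒minor : ∀ {D₀} → CircuitThrough e f D₀ → HasMinorUsing M indepW₂ e f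
    earless⇒minor {D₀} through₀@(cD₀ , e∈D₀ , _) with small-circuit through₀
    ... | Q , cQ , ∣Q∣≤ with minimum (circuitThrough? e f) (λ D → ∣ Q ─ D ∣) D₀ through₀
    ... | D , closestD@(throughD , _) =
      closest⇒minor cQ (≤-trans ∣Q∣≤ (rank-bound throughD (proj₂ cD₀ e e∈D₀))) closestD

  W₂-minor : ∀ e f → e ≢ f → HasMinorUsing M indepW₂ e f
  W₂-minor e f e≢f with anySubset? (λ D → circuitThrough? e f D ×-dec anySubset? (ear? D))
  ... | yes (D , (cD , e∈D , f∈D) , Z , ear-Z) = ear⇒minor cD e∈D f∈D e≢f ear-Z
  ... | no earless = let D₀ , throughD₀ = connected e f e≢f in earless⇒minor e≢f earless throughD₀

image : (Fin k → Fin n) → Subset k → Subset n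
image φ X = tabulate λ y → does (any? λ i → (i ∈? X) ×-dec (φ i ≟ᶠ y))

∈-image⁺ : ∀ {φ : Fin k → Fin n} {X i} → i ∈ X → φ i ∈ image φ X
∈-image⁺ {φ = φ} {X} {i} i∈X =
  lookup⇒[]= (φ i) (image φ X) (trans (lookup∘tabulate _ (φ i)) (dec-true (any? _) (i , i∈X , refl)))

∈-image⁻ : ∀ {φ : Fin k → Fin n} {X y} → y ∈ image φ X → ∃[ i ] (i ∈ X × φ i ≡ y)
∈-image⁻ {φ = φ} {X} {y} y∈
  with any? (λ i → (i ∈? X) ×-dec (φ i ≟ᶠ y)) | trans (sym (lookup∘tabulate _ y)) ([]=⇒lookup y∈)
... | yes preimage | _ = preimage
... | no _ | ()

module _ {M : Matroid n} {N : Matroid k} where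
  open MatroidProperties M

  basis-exists : ∀ C → ∃[ J ] IsBasisOf M J C
  basis-exists C =
    let J , _ , J⊆C , iJ , maximal = extend-to-maximal C ⊥ ⊥⊆ (indep-empty M) in J , J⊆C , iJ , maximal

  module _ {C S : Subset n} (C∩S≡∅ : Empty (C ∩ S)) {φ : Fin k → Fin n} (φ-injective : Injective _≡_ _≡_ φ)
           (φ∈S : ∀ i → φ i ∈ S)
           (≅ : ∀ X Y → Y ⊆ S → (∀ i → (i ∈ X ⇔ φ i ∈ Y)) → (indep N X ≡ true ⇔ IndepContract M C Y)) where

    image⊆S : ∀ X → image φ X ⊆ S
    image⊆S X y∈ = let i , _ , φi≡y = ∈-image⁻ y∈ in subst (_∈ S) φi≡y (φ∈S i)

    image∩C≡∅ : ∀ X → Empty (image φ X ∩ C)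
    image∩C≡∅ X (x , x∈) = let x∈Y , x∈C = x∈p∩q⁻ _ C x∈ in C∩S≡∅ (x , x∈p∩q⁺ (x∈C , image⊆S X x∈Y))

    ≅-image : ∀ X → (indep N X ≡ true ⇔ IndepContract M C (image φ X))
    ≅-image X = ≅ X (image φ X) (image⊆S X) λ i → mk⇔ ∈-image⁺ λ φi∈ →
      let j , j∈X , φj≡φi = ∈-image⁻ φi∈ in subst (_∈ X) (φ-injective φj≡φi) j∈X

    -- If φ j were missing from the circuit Z ⊆ image W ∪ J, then Z ⊆ image (W - j) ∪ J, which is
    -- independent because W - j is independent in N and any basis of C can be used to test this.
    circuit-lifts : ∀ {W} → IsCircuit N W → ∃[ Z ] (Circuit Z × ∀ j → j ∈ W → φ j ∈ Z)
    circuit-lifts {W} (dW , W-j-indep) with basis-exists C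
    ... | J , bJ@(J⊆C , _) with indep⊎dep (image φ W ∪ J)
    ... | inj₁ iWJ = ⊥-elim (not-¬ (Equivalence.from (≅-image W) (J , bJ , iWJ)) dW)
    ... | inj₂ dWJ = let Z , cZ , Z⊆WJ = dep⇒circuit⊆ _ dWJ in Z , cZ , λ j j∈W → φj∈Z Z⊆WJ cZ j j∈W
      where
      φj∈Z : ∀ {Z} → Z ⊆ image φ W ∪ J → Circuit Z → ∀ j → j ∈ W → φ j ∈ Z
      φj∈Z {Z} Z⊆WJ cZ j j∈W with φ j ∈? Z
      ... | yes φj∈Z = φj∈Z
      ... | no φj∉Z = ⊥-elim (indep⇒¬dep (indep-⊆ Z⊆W-jJ iW-jJ) (proj₁ cZ))
        where
        Z⊆W-jJ : Z ⊆ image φ (W - j) ∪ J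
        Z⊆W-jJ z∈Z with x∈p∪q⁻ (image φ W) J (Z⊆WJ z∈Z)
        ... | inj₂ z∈J = q⊆p∪q _ J z∈J
        ... | inj₁ z∈W with ∈-image⁻ {φ = φ} z∈W
        ... | i , i∈W , refl = p⊆p∪q J (∈-image⁺ (x∈p∧x≢y⇒x∈p-y i∈W λ { refl → φj∉Z z∈Z }))
        iW-jJ : Indep (image φ (W - j) ∪ J)
        iW-jJ = let J′ , bJ′@(J′⊆C , _) , iW-jJ′ = Equivalence.to (≅-image (W - j)) (W-j-indep j j∈W)
                in indep-∪-basis bJ bJ′ (image∩C≡∅ (W - j)) iW-jJ′

    ≅-pair : ∀ i j → (indep N (⁅ i ⁆ ∪ ⁅ j ⁆) ≡ true ⇔ IndepContract M C (⁅ φ i ⁆ ∪ ⁅ φ j ⁆))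
    ≅-pair i j = ≅ _ _ pair⊆S λ x → mk⇔ (to x) (from x)
      where
      pair⊆S : ⁅ φ i ⁆ ∪ ⁅ φ j ⁆ ⊆ S
      pair⊆S y∈ = [ (λ { refl → φ∈S i }) , (λ { refl → φ∈S j }) ]′ (x∈⁅y⁆∪⁅z⁆⁻ y∈)
      to : ∀ x → x ∈ ⁅ i ⁆ ∪ ⁅ j ⁆ → φ x ∈ ⁅ φ i ⁆ ∪ ⁅ φ j ⁆
      to x x∈ = [ (λ { refl → p⊆p∪q _ (x∈⁅x⁆ (φ i)) }) , (λ { refl → q⊆p∪q _ _ (x∈⁅x⁆ (φ j)) }) ]′ (x∈⁅y⁆∪⁅z⁆⁻ x∈)
      from : ∀ x → φ x ∈ ⁅ φ i ⁆ ∪ ⁅ φ j ⁆ → x ∈ ⁅ i ⁆ ∪ ⁅ j ⁆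
      from x φx∈ with x∈⁅y⁆∪⁅z⁆⁻ φx∈
      ... | inj₁ φx≡φi = subst (_∈ ⁅ i ⁆ ∪ ⁅ j ⁆) (sym (φ-injective φx≡φi)) (p⊆p∪q _ (x∈⁅x⁆ i))
      ... | inj₂ φx≡φj = subst (_∈ ⁅ i ⁆ ∪ ⁅ j ⁆) (sym (φ-injective φx≡φj)) (q⊆p∪q _ _ (x∈⁅x⁆ j))

    dependent-and-independent-pair⇒¬uniform : ∀ {i j l m} → i ≢ j → l ≢ m →
      indep N (⁅ i ⁆ ∪ ⁅ j ⁆) ≡ false → indep N (⁅ l ⁆ ∪ ⁅ m ⁆) ≡ true → ¬ Uniform M
    dependent-and-independent-pair⇒¬uniform {i} {j} {l} {m} i≢j l≢m dij ilm (r , uniform)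
      with Equivalence.to (≅-pair l m) ilm
    ... | J , bJ@(J⊆C , _) , ilmJ =
      not-¬ (Equivalence.from (≅-pair i j) (J , bJ , Equivalence.from (uniform _) ∣ijJ∣≤r)) dij
      where
      ∣ijJ∣≤r : ∣ (⁅ φ i ⁆ ∪ ⁅ φ j ⁆) ∪ J ∣ ≤ r
      ∣ijJ∣≤r = subst (_≤ r) ∣lmJ∣≡∣ijJ∣ (Equivalence.to (uniform _) ilmJ)
        where
        ∣pair∪J∣≡2+∣J∣ : ∀ {x y} → x ≢ y → ∣ (⁅ φ x ⁆ ∪ ⁅ φ y ⁆) ∪ J ∣ ≡ 2 + ∣ J ∣
        ∣pair∪J∣≡2+∣J∣ {x} {y} x≢y = begin
          ∣ (⁅ φ x ⁆ ∪ ⁅ φ y ⁆) ∪ J ∣      ≡⟨ ∣p∪q∣≡∣p∣+∣q∣ _ J (disjoint pair⊆S) ⟩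
          ∣ ⁅ φ x ⁆ ∪ ⁅ φ y ⁆ ∣ + ∣ J ∣    ≡⟨ cong (_+ ∣ J ∣) (∣⁅x⁆∪p∣≡1+∣p∣ ⁅ φ y ⁆ φx∉φy) ⟩
          suc ∣ ⁅ φ y ⁆ ∣ + ∣ J ∣          ≡⟨ cong (λ s → suc s + ∣ J ∣) (∣⁅x⁆∣≡1 (φ y)) ⟩
          2 + ∣ J ∣                        ∎
          where
          open ≡-Reasoning
          φx∉φy : φ x ∉ ⁅ φ y ⁆
          φx∉φy = x≢y ∘ φ-injective ∘ x∈⁅y⁆⇒x≡y (φ y)
          pair⊆S : ⁅ φ x ⁆ ∪ ⁅ φ y ⁆ ⊆ S
          pair⊆S z∈ = [ (λ { refl → φ∈S x }) , (λ { refl → φ∈S y }) ]′ (x∈⁅y⁆∪⁅z⁆⁻ z∈)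
          disjoint : ∀ {Y} → Y ⊆ S → Empty (Y ∩ J)
          disjoint Y⊆S (z , z∈) = let z∈Y , z∈J = x∈p∩q⁻ _ J z∈ in C∩S≡∅ (z , x∈p∩q⁺ (J⊆C z∈J , Y⊆S z∈Y))
        ∣lmJ∣≡∣ijJ∣ = trans (∣pair∪J∣≡2+∣J∣ l≢m) (sym (∣pair∪J∣≡2+∣J∣ i≢j))

  connected-minors⇒connected : Connected N → (∀ e f → e ≢ f → HasMinorUsing M (indep N) e f) → Connected M
  connected-minors⇒connected connectedN minors e f e≢f with minors e f e≢f
  ... | C , S , C∩S≡∅ , e∈S , f∈S , φ , φ-injective , φ∈S , S⊆φ , ≅ with S⊆φ e e∈S | S⊆φ f f∈S
  ... | i , refl | j , refl with connectedN i j (e≢f ∘ cong φ)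
  ... | W , cW , i∈W , j∈W =
    let Z , cZ , φW⊆Z = circuit-lifts C∩S≡∅ φ-injective φ∈S ≅ cW in Z , cZ , φW⊆Z i i∈W , φW⊆Z j j∈W

W₂-connected : Connected W₂
W₂-connected = from-yes (all? λ e → all? λ f → ¬? (e ≟ᶠ f) →-dec
  anySubset? λ C → MatroidProperties.circuit? W₂ C ×-dec ((e ∈? C) ×-dec (f ∈? C)))

W₂-connected⇒¬uniform : ∀ {M : Matroid n} → NConnected M W₂ → ¬ Uniform M
W₂-connected⇒¬uniform {zero} (() , _)
W₂-connected⇒¬uniform {suc zero} (s≤s () , _)
W₂-connected⇒¬uniform {suc (suc _)} {M} (_ , minors) with minors zero (suc zero) (λ ())
... | C , S , C∩S≡∅ , _ , _ , φ , φ-injective , φ∈S , _ , ≅ =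
  dependent-and-independent-pair⇒¬uniform {M = M} {N = W₂} C∩S≡∅ φ-injective φ∈S ≅
    {# 0} {# 1} {# 0} {# 2} (λ ()) (λ ()) refl refl

¬uniform⇒2≤n : ∀ (M : Matroid n) → ¬ Uniform M → 2 ≤ n
¬uniform⇒2≤n {zero} M nonuniform = ⊥-elim (nonuniform (0 , λ { [] → mk⇔ (λ _ → z≤n) (λ _ → indep-empty M) }))
¬uniform⇒2≤n {suc zero} M nonuniform with indep M (true ∷ []) in indep-point
... | true = ⊥-elim (nonuniform (1 , λ where
  (true ∷ []) → mk⇔ (λ _ → s≤s z≤n) (λ _ → indep-point)
  (false ∷ []) → mk⇔ (λ _ → z≤n) (λ _ → indep-empty M)))
... | false = ⊥-elim (nonuniform (0 , λ where
  (true ∷ []) → mk⇔ (λ indep-point′ → ⊥-elim (not-¬ indep-point′ indep-point)) λ ()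
  (false ∷ []) → mk⇔ (λ _ → z≤n) (λ _ → indep-empty M)))
¬uniform⇒2≤n {suc (suc _)} M _ = s≤s (s≤s z≤n)

theorem4p1 : ∀ {n : ℕ} (M : Matroid n) →
    NConnected M W₂ ⇔ (Connected M × ¬ Uniform M)
theorem4p1 M = mk⇔
  (λ W₂-connected-M → connected-minors⇒connected {M = M} {N = W₂} W₂-connected (proj₂ W₂-connected-M) ,
                      W₂-connected⇒¬uniform {M = M} W₂-connected-M)
  (λ (connected , nonuniform) → ¬uniform⇒2≤n M nonuniform , Sufficiency.W₂-minor M connected nonuniform)
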